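{- Let $\lambda\supseteq\mu$ be partitions, $r=\mathrm{rank}(\lambda/\mu)$, and let $(q_k)_{k\in\mathbb{Z}}$ be the snake sequence of $\lambda/\mu$. There exists a unique set $\mathcal{P}(\lambda/\mu)=\{(u_1,v_1),\dots,(u_r,v_r)\}$ of pairs of integers such that: (a) the $2r$ integers $u_i,v_i$ are distinct; (b) $u_i<v_i$ for all $i$; (c) for each $i$ there is $t$ (depending on $i$) with $q_{u_i}=L_t$ and $q_{v_i}=R_t$; (d) there are no $i,j$ with $u_i<u_j<v_i<v_j$.
   Context: Skew diagram $\lambda/\mu=\{(i,j):\mu_i<j\le\lambda_i\}$; square $(i,j)$ is drawn as $[j-1,j]\times[-i,-i+1]$. An outside top corner is $(i,j)\in\lambda/\mu$ with $(i-1,j),(i,j-1)\notin\lambda/\mu$; an inside top corner is $(i,j)\in\lambda/\mu$ with $(i-1,j),(i,j-1)\in\lambda/\mu$, $(i-1,j-1)\notin\lambda/\mu$; the diagonal of a corner $(i,j)$ is the set of $(i+p,j+p)\in\lambda/\mu$, $p\ge0$; $\mathrm{rank}(\lambda/\mu)$ is the number of squares on outside diagonals minus the number on inside diagonals. For a partition $\alpha$, its boundary path goes up $x=0$ from $y=-\infty$ to $(0,-\ell(\alpha))$, follows the lower-right boundary of the diagram of $\alpha$ to $(\alpha_1,0)$, then right along $y=0$; the unit step starting at $(x,y)$ has index $x+y$. For $k\in\mathbb{Z}$ let $e_k$ be step $k$ of the boundary path of $\lambda$. If $e_k$ is also a step of the boundary path of $\mu$, $S_k=\emptyset$. Otherwise,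 if $e_k$ is horizontal it is the lower edge of a square $(i,j)\in\lambda/\mu$ and $S_k=(\lambda/\mu)\cap\{(i,j),(i,j-1),(i-1,j-1),(i-1,j-2),\dots\}$; if vertical it is the right edge of $(i,j)\in\lambda/\mu$ and $S_k=(\lambda/\mu)\cap\{(i,j),(i-1,j),(i-1,j-1),(i-2,j-1),\dots\}$. Length $\ell(S_k)=|S_k|-1$. $S_k$ is a left snake if $e_k$ is horizontal and $\ell(S_k)$ is even (and $\ge0$), a right snake if $e_k$ is vertical and $\ell(S_k)$ is even. The snake sequence is $q_k=L_m$ if $S_k$ is a left snake of length $2m$, $q_k=R_m$ if $S_k$ is a right snake of length $2m$, and $q_k=O$ otherwise. -}

module Defs where

open import Data.Nat as ℕ using (ℕ; zero; suc; _≥_)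
open import Data.Integer as ℤ using (ℤ; +_; -[1+_]; _-_; _<_; _≤_; ∣_∣; 1ℤ; 0ℤ)
import Data.Integer.Properties as ℤP
import Data.Nat.Properties as ℕP
open import Data.List using (List; []; _∷_; map; length; filter; concatMap; upTo; lookup)
open import Data.Nat.ListAction using (sum)
open import Data.List.Relation.Unary.Linked using (Linked)
open import Data.List.Relation.Unary.All using (All)
open import Data.List.Relation.Unary.Unique.Propositional using (Unique)
open import Data.List.Membership.Propositional using (_∈_)
open import Data.Bool using (Bool; true; false; if_then_else_)
open import Data.Maybe using (Maybe; just; nothing)
import Data.Maybe as Maybe
open import Data.Product using (_×_; _,_; ∃-syntax; proj₁; proj₂)
open import Relation.Nullary using (Dec; yes; no; ¬_)
open import Relation.Nullary.Decidable using (⌊_⌋; _×-dec_; ¬?)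
open import Relation.Binary.PropositionalEquality using (_≡_; refl; cong; cong₂)

-- Partitions: finite weakly decreasing lists of naturals (trailing
-- zeros are allowed and harmless).  Parts are 1-indexed; part α i = 0
-- for i = 0 or i > length α.

IsPartition : List ℕ → Set
IsPartition = Linked _≥_

part : List ℕ → ℕ → ℕ
part []       _             = 0
part (x ∷ xs) zero          = 0
part (x ∷ xs) (suc zero)    = x
part (x ∷ xs) (suc (suc i)) = part xs (suc i)

_⊆ᵖ_ : List ℕ → List ℕ → Set
μ ⊆ᵖ lam = ∀ i → part μ i ℕ.≤ part lam i

row : List ℕ → ℤ → ℕ
row α (+ n)    = part α n
row α -[1+ n ] = 0

range : ℕ → List ℕ
range n = map suc (upTo n)

InSkew : List ℕ → List ℕ → ℤ → ℤ → Set
InSkew lam μ i j = (1ℤ ≤ i) × (+ row μ i < j) × (j ≤ + row lam i)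

inSkew? : ∀ lam μ i j → Dec (InSkew lam μ i j)
inSkew? lam μ i j = (1ℤ ℤ.≤? i) ×-dec ((+ row μ i ℤ.<? j) ×-dec (j ℤ.≤? + row lam i))

[_] : ∀ {A : Set} → Dec A → ℕ
[ yes _ ] = 1
[ no  _ ] = 0

OutsideCorner : List ℕ → List ℕ → ℤ → ℤ → Set
OutsideCorner lam μ i j =
  InSkew lam μ i j × ¬ InSkew lam μ (i - 1ℤ) j × ¬ InSkew lam μ i (j - 1ℤ)

InsideCorner : List ℕ → List ℕ → ℤ → ℤ → Set
InsideCorner lam μ i j =
  InSkew lam μ i j × InSkew lam μ (i - 1ℤ) j × InSkew lam μ i (j - 1ℤ)
  × ¬ InSkew lam μ (i - 1ℤ) (j - 1ℤ)

outsideCorner? : ∀ lam μ i j → Dec (OutsideCorner lam μ i j)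
outsideCorner? lam μ i j =
  inSkew? lam μ i j ×-dec (¬? (inSkew? lam μ (i - 1ℤ) j) ×-dec ¬? (inSkew? lam μ i (j - 1ℤ)))

insideCorner? : ∀ lam μ i j → Dec (InsideCorner lam μ i j)
insideCorner? lam μ i j =
  inSkew? lam μ i j ×-dec (inSkew? lam μ (i - 1ℤ) j ×-dec
    (inSkew? lam μ i (j - 1ℤ) ×-dec ¬? (inSkew? lam μ (i - 1ℤ) (j - 1ℤ))))

-- number of squares (i+p, j+p) ∈ λ/μ, p ≥ 0 (all such lie in rows ≤ length λ)
diagLen : List ℕ → List ℕ → ℤ → ℤ → ℕ
diagLen lam μ i j =
  sum (map (λ p → [ inSkew? lam μ (i ℤ.+ + p) (j ℤ.+ + p) ]) (upTo (suc (length lam))))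

cells : List ℕ → List (ℤ × ℤ)
cells lam = concatMap (λ i → map (λ j → (+ i , + j)) (range (part lam 1))) (range (length lam))

rank : List ℕ → List ℕ → ℤ
rank lam μ =
    + sum (map (λ c → [ outsideCorner? lam μ (proj₁ c) (proj₂ c) ] ℕ.* diagLen lam μ (proj₁ c) (proj₂ c)) (cells lam))
  - + sum (map (λ c → [ insideCorner?  lam μ (proj₁ c) (proj₂ c) ] ℕ.* diagLen lam μ (proj₁ c) (proj₂ c)) (cells lam))

-- A step is recorded by the square it bounds:
--   hor i j : the lower edge of square (i,j)   (i ≥ 0),
--   ver i j : the right edge of square (i,j)   (i ≥ 1, j ≥ 0).
-- Square (i,j) = [j-1,j]×[-i,-i+1], so hor i j starts at (j-1,-i),
-- index j-1-i, and ver i j starts at (j,-i), index j-i.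

data Step : Set where
  hor ver : ℤ → ℤ → Step

step? : (s t : Step) → Dec (s ≡ t)
step? (hor i j) (hor i' j') with i ℤ.≟ i' | j ℤ.≟ j'
... | yes refl | yes refl = yes refl
... | no ne    | _        = no λ { refl → ne refl }
... | yes _    | no ne    = no λ { refl → ne refl }
step? (ver i j) (ver i' j') with i ℤ.≟ i' | j ℤ.≟ j'
... | yes refl | yes refl = yes refl
... | no ne    | _        = no λ { refl → ne refl }
... | yes _    | no ne    = no λ { refl → ne refl }
step? (hor _ _) (ver _ _) = no λ ()
step? (ver _ _) (hor _ _) = no λ ()

-- The vertical steps of the boundary path of α are exactly ver r α_r
-- (r ≥ 1), of index α_r - r (strictly decreasing in r).  The
-- horizontal step of index k lies in row i = #{r ≥ 1 : α_r - r > k},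
-- and is the lower edge of square (i, k+1+i).  Rows r > length α + |k|
-- never matter for index k, so we search r ∈ 1..length α + |k|.
searchRows : List ℕ → ℤ → List ℕ
searchRows α k = range (length α ℕ.+ ∣ k ∣)

stepAt : List ℕ → ℤ → Step
stepAt α k with filter (λ r → (+ part α r - + r) ℤ.≟ k) (searchRows α k)
... | r ∷ _ = ver (+ r) (+ part α r)
... | []    = hor (+ i) (k ℤ.+ 1ℤ ℤ.+ + i)
  where i = length (filter (λ r → k ℤ.<? (+ part α r - + r)) (searchRows α k))

-- |S_k| for a horizontal step below (i,j): squares of λ/μ among
-- (i,j),(i,j-1),(i-1,j-1),(i-1,j-2),...  (rows ≤ 0 contain no squares)
stairH : List ℕ → List ℕ → ℤ → ℤ → ℕ
stairH lam μ i j = sum (map (λ p →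
    [ inSkew? lam μ (i - + p) (j - + p) ] ℕ.+ [ inSkew? lam μ (i - + p) (j - + p - 1ℤ) ])
  (upTo (suc ∣ i ∣)))

-- |S_k| for a vertical step right of (i,j): squares of λ/μ among
-- (i,j),(i-1,j),(i-1,j-1),(i-2,j-1),...
stairV : List ℕ → List ℕ → ℤ → ℤ → ℕ
stairV lam μ i j = sum (map (λ p →
    [ inSkew? lam μ (i - + p) (j - + p) ] ℕ.+ [ inSkew? lam μ (i - + p - 1ℤ) (j - + p) ])
  (upTo (suc ∣ i ∣)))

sizeS : List ℕ → List ℕ → ℤ → ℕ
sizeS lam μ k with step? (stepAt lam k) (stepAt μ k)
... | yes _ = 0
... | no _ with stepAt lam k
...   | hor i j = stairH lam μ i j
...   | ver i j = stairV lam μ i j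

data Snake : Set where
  L R : ℕ → Snake
  O   : Snake

half : ℕ → Maybe ℕ
half zero          = just zero
half (suc zero)    = nothing
half (suc (suc n)) = Maybe.map suc (half n)

-- q_k: L_m / R_m if S_k is a left / right snake of length ℓ(S_k) = |S_k|-1 = 2m
snakeSeq : List ℕ → List ℕ → ℤ → Snake
snakeSeq lam μ k with sizeS lam μ k
... | zero = O
... | suc ℓ with half ℓ | stepAt lam k
...   | nothing | _       = O
...   | just m  | hor _ _ = L m
...   | just m  | ver _ _ = R m

flatten : List (ℤ × ℤ) → List ℤ
flatten = concatMap (λ uv → proj₁ uv ∷ proj₂ uv ∷ [])

Valid : List ℕ → List ℕ → List (ℤ × ℤ) → Set
Valid lam μ P =
    (+ length P ≡ rank lam μ)
  × Unique (flatten P)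
  × All (λ uv → proj₁ uv < proj₂ uv) P
  × All (λ uv → ∃[ t ] (snakeSeq lam μ (proj₁ uv) ≡ L t
                       × snakeSeq lam μ (proj₂ uv) ≡ R t)) P
  × (∀ {a b} → a ∈ P → b ∈ P →
       ¬ (proj₁ a < proj₁ b × proj₁ b < proj₂ a × proj₂ a < proj₂ b))

-- Let the thickness N(k) be the number of squares of λ/μ of content k + 1. The snake
-- S_k consists of the squares of contents k and k + 1 next to step k, so
-- |S_k| = N(k - 1) + N(k); as N moves by at most one per step, q_k = L_t exactly when
-- N rises from t to t + 1 at k (a horizontal step of λ) and q_k = R_t exactly when N
-- falls from t + 1 to t (a vertical step). So (q_k) is the up/down word of a lattice path
-- from height 0 back to 0, and (a)-(d) force every up step to be paired with the first
-- return of the path to its starting height: the pairs are unique, they exist, and there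
-- are as many as rises of N. Finally, summed diagonal by diagonal, outside corners add and
-- inside corners subtract the thickness of their diagonal, and this telescopes to the
-- number of rises, i.e. the rank.

module Submission where

open import Defs
open import Data.Nat as ℕ using (ℕ; zero; suc; z≤n; s≤s)
import Data.Nat.Properties as ℕP
open import Data.Integer as ℤ using (ℤ; +_; -[1+_]; _+_; _-_; -_; _<_; _≤_; ∣_∣; 1ℤ; +≤+; -<+)
import Data.Integer.Properties as ℤP
open import Data.Integer.Tactic.RingSolver using (solve-∀)
open import Data.List using (List; []; _∷_; _++_; length; filter; map; upTo; concatMap)
open import Data.List.Relation.Unary.Linked using ([]; [-]; _∷_)
open import Data.Nat.ListAction using (sum)
open import Data.Nat.ListAction.Properties using (sum-++)
open import Data.Nat.Tactic.RingSolver using () renaming (solve-∀ to ℕ-solve-∀)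
import Data.List.Properties as LP
open import Data.List.Membership.Propositional using (_∈_)
open import Data.List.Membership.Propositional.Properties using (∈-upTo⁻; ∈-upTo⁺; ∈-∃++; ∈-++⁻; ∈-++⁺ˡ; ∈-++⁺ʳ; ∈-filter⁺; ∈-filter⁻; ∈-map⁺; ∈-map⁻)
open import Data.List.Membership.DecPropositional using (_∈?_)
open import Data.List.Relation.Unary.Any using (here; there)
open import Data.List.Relation.Unary.All as All using (All; []; _∷_)
open import Data.List.Relation.Unary.AllPairs using ([]; _∷_)
open import Data.List.Relation.Unary.Unique.Propositional using (Unique)
import Data.List.Relation.Unary.Unique.Propositional.Properties as UniqueP
open import Data.Product using (_×_; _,_; ∃-syntax; proj₁; proj₂)
open import Data.Maybe using (just; nothing)
open import Data.Sum using (_⊎_; inj₁; inj₂)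
open import Data.Empty using (⊥; ⊥-elim)
open import Function.Bundles using (_⇔_; mk⇔)
open import Relation.Nullary using (Dec; yes; no; ¬_)
open import Relation.Nullary.Decidable using (_×-dec_)
open import Relation.Unary using (Decidable)
open import Relation.Binary.Definitions using (tri<; tri≈; tri>)
open import Relation.Binary.PropositionalEquality hiding ([_])

i≤j⇒∃[d]j≡i+d : ∀ {i j} → i ≤ j → ∃[ d ] (j ≡ i + + d)
i≤j⇒∃[d]j≡i+d {i} {j} i≤j = ∣ j - i ∣ , (begin
    j                ≡⟨ j≡i+[j-i] i j ⟩
    i + (j - i)      ≡⟨ cong (λ x → i + x) (sym (ℤP.0≤i⇒+∣i∣≡i (ℤP.i≤j⇒0≤j-i i≤j))) ⟩
    i + + ∣ j - i ∣  ∎)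
  where
  open ≡-Reasoning
  j≡i+[j-i] : ∀ i j → j ≡ i + (j - i)
  j≡i+[j-i] = solve-∀

i<j⇒i+1≤j : ∀ {i j} → i < j → i + 1ℤ ≤ j
i<j⇒i+1≤j {i} {j} i<j = subst (_≤ j) (ℤP.+-comm 1ℤ i) (ℤP.i<j⇒suc[i]≤j i<j)

i+1≤j⇒i<j : ∀ {i j} → i + 1ℤ ≤ j → i < j
i+1≤j⇒i<j {i} {j} i+1≤j = ℤP.suc[i]≤j⇒i<j (subst (_≤ j) (ℤP.+-comm i 1ℤ) i+1≤j)

i+1-1≡i : ∀ i → i + 1ℤ - 1ℤ ≡ i
i+1-1≡i = solve-∀

i-1+1≡i : ∀ i → i - 1ℤ + 1ℤ ≡ i
i-1+1≡i = solve-∀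

i<j⇒i≤j-1 : ∀ {i j} → i < j → i ≤ j - 1ℤ
i<j⇒i≤j-1 {i} {j} i<j = subst (_≤ j - 1ℤ) (i+1-1≡i i) (ℤP.+-monoˡ-≤ (- 1ℤ) (i<j⇒i+1≤j i<j))

i≤j-1⇒i<j : ∀ {i j} → i ≤ j - 1ℤ → i < j
i≤j-1⇒i<j {i} {j} i≤j-1 = i+1≤j⇒i<j (subst (i + 1ℤ ≤_) (i-1+1≡i j) (ℤP.+-monoˡ-≤ 1ℤ i≤j-1))

i-1<i : ∀ i → i - 1ℤ < i
i-1<i i = i≤j-1⇒i<j ℤP.≤-refl

i<i+1 : ∀ i → i < i + 1ℤ
i<i+1 i = i+1≤j⇒i<j ℤP.≤-refl

+-cancelˡ-< : ∀ i {j k} → i + j < i + k → j < k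
+-cancelˡ-< i {j} {k} lt = subst₂ _<_ (-i+[i+j]≡j i j) (-i+[i+j]≡j i k) (ℤP.+-monoʳ-< (- i) lt)
  where
  -i+[i+j]≡j : ∀ i j → - i + (i + j) ≡ j
  -i+[i+j]≡j = solve-∀

interval : ℤ → ℕ → List ℤ
interval a zero    = []
interval a (suc n) = a ∷ interval (a + 1ℤ) n

∈-interval⁻ : ∀ {a n k} → k ∈ interval a n → a ≤ k × k < a + + n
∈-interval⁻ {a} {suc n} (here refl) =
  ℤP.≤-refl , ℤP.<-≤-trans (i<i+1 a) (ℤP.≤-trans (ℤP.i≤i+j (a + 1ℤ) (+ n)) (ℤP.≤-reflexive (ℤP.+-assoc a 1ℤ (+ n))))
∈-interval⁻ {a} {suc n} {k} (there k∈) with ∈-interval⁻ k∈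
... | a+1≤k , k<a+1+n = ℤP.<⇒≤ (i+1≤j⇒i<j a+1≤k) , subst (k <_) (ℤP.+-assoc a 1ℤ (+ n)) k<a+1+n

∈-interval⁺ : ∀ {a n k} → a ≤ k → k < a + + n → k ∈ interval a n
∈-interval⁺ {a} {zero} {k} a≤k k<a =
  ⊥-elim (ℤP.<-irrefl refl (ℤP.<-≤-trans k<a (subst (_≤ k) (sym (ℤP.+-identityʳ a)) a≤k)))
∈-interval⁺ {a} {suc n} {k} a≤k k<a+n with a ℤ.≟ k
... | yes refl = here refl
... | no a≢k   = there (∈-interval⁺ (i<j⇒i+1≤j (ℤP.≤∧≢⇒< a≤k a≢k)) (subst (k <_) (sym (ℤP.+-assoc a 1ℤ (+ n))) k<a+n))

interval-unique : ∀ a n → Unique (interval a n)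
interval-unique a zero    = []
interval-unique a (suc n) =
  All.tabulate (λ k∈ a≡k → ℤP.<-irrefl a≡k (i+1≤j⇒i<j (proj₁ (∈-interval⁻ k∈)))) ∷ interval-unique (a + 1ℤ) n

module _ {P : ℕ → Set} (P? : Decidable P) where

  private
    least-below : ∀ n → (∃[ d ] (d ℕ.≤ n × P d × (∀ e → e ℕ.< d → ¬ P e))) ⊎ (∀ e → e ℕ.≤ n → ¬ P e)
    least-below zero with P? zero
    ... | yes p  = inj₁ (0 , z≤n , p , λ _ ())
    ... | no ¬p  = inj₂ λ { zero _ → ¬p }
    least-below (suc n) with least-below n
    ... | inj₁ (d , d≤n , p , min) = inj₁ (d , ℕP.m≤n⇒m≤1+n d≤n , p , min)
    ... | inj₂ none with P? (suc n)
    ...   | yes p = inj₁ (suc n , ℕP.≤-refl , p , λ e e<1+n → none e (ℕP.≤-pred e<1+n))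
    ...   | no ¬p = inj₂ λ e e≤1+n → below e (ℕP.m≤n⇒m<n∨m≡n e≤1+n)
      where
      below : ∀ e → e ℕ.< suc n ⊎ e ≡ suc n → ¬ P e
      below e (inj₁ e<1+n) = none e (ℕP.≤-pred e<1+n)
      below e (inj₂ refl)  = ¬p

  least-witness : ∀ {n} → P n → ∃[ d ] (P d × (∀ e → e ℕ.< d → ¬ P e))
  least-witness {n} pn with least-below n
  ... | inj₁ (d , _ , p , min) = d , p , min
  ... | inj₂ none              = ⊥-elim (none n ℕP.≤-refl pn)

module _ {A : Set} where

  unique-length-≤ : ∀ {xs ys : List A} → Unique xs → (∀ {x} → x ∈ xs → x ∈ ys) → length xs ℕ.≤ length ys
  unique-length-≤ {[]}     _            _  = z≤n
  unique-length-≤ {x ∷ xs} {ys} (x∉xs ∷ u) xs⊆ys with ∈-∃++ (xs⊆ys (here refl))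
  ... | ys₁ , ys₂ , refl =
    subst (suc (length xs) ℕ.≤_) (sym (LP.length-++-sucʳ ys₁ x ys₂)) (s≤s (unique-length-≤ u xs⊆ys₁++ys₂))
    where
    xs⊆ys₁++ys₂ : ∀ {z} → z ∈ xs → z ∈ ys₁ ++ ys₂
    xs⊆ys₁++ys₂ {z} z∈xs with ∈-++⁻ ys₁ (xs⊆ys (there z∈xs))
    ... | inj₁ z∈ys₁         = ∈-++⁺ˡ z∈ys₁
    ... | inj₂ (here refl)   = ⊥-elim (All.lookup x∉xs z∈xs refl)
    ... | inj₂ (there z∈ys₂) = ∈-++⁺ʳ ys₁ z∈ys₂

  unique-⊆-length-≥⇒⊇ : (_≟_ : (x y : A) → Dec (x ≡ y)) → ∀ {xs ys : List A} → Unique xs →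
    (∀ {x} → x ∈ xs → x ∈ ys) → length ys ℕ.≤ length xs → ∀ {y} → y ∈ ys → y ∈ xs
  unique-⊆-length-≥⇒⊇ _≟_ {xs} {ys} u xs⊆ys ys≤xs {y} y∈ys with (_∈?_ _≟_) y xs
  ... | yes y∈xs = y∈xs
  ... | no  y∉xs = ⊥-elim (ℕP.<-irrefl refl (ℕP.<-≤-trans (unique-length-≤ (y∉ ∷ u) y∷xs⊆ys) ys≤xs))
    where
    y∉ : All (y ≢_) xs
    y∉ = All.tabulate λ x∈xs y≡x → y∉xs (subst (_∈ xs) (sym y≡x) x∈xs)
    y∷xs⊆ys : ∀ {x} → x ∈ y ∷ xs → x ∈ ys
    y∷xs⊆ys (here refl) = y∈ys
    y∷xs⊆ys (there x∈xs) = xs⊆ys x∈xs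

[_]-yes : ∀ {A : Set} (d : Dec A) → A → [ d ] ≡ 1
[ yes _ ]-yes _ = refl
[ no ¬a ]-yes a = ⊥-elim (¬a a)

[_]-no : ∀ {A : Set} (d : Dec A) → ¬ A → [ d ] ≡ 0
[ yes a ]-no ¬a = ⊥-elim (¬a a)
[ no _  ]-no _  = refl

[×-dec]≡* : ∀ {A B : Set} (d : Dec A) (e : Dec B) → [ d ×-dec e ] ≡ [ d ] ℕ.* [ e ]
[×-dec]≡* (yes _) (yes _) = refl
[×-dec]≡* (yes _) (no  _) = refl
[×-dec]≡* (no  _) _       = refl

[_]-cong : ∀ {A B : Set} (d : Dec A) (e : Dec B) → (A → B) → (B → A) → [ d ] ≡ [ e ]
[ yes a ]-cong e f g = sym ([ e ]-yes (f a))
[ no ¬a ]-cong e f g = sym ([ e ]-no (λ b → ¬a (g b)))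

length-filter : ∀ {A : Set} {P : A → Set} (P? : Decidable P) (xs : List A) →
  length (filter P? xs) ≡ sum (map (λ x → [ P? x ]) xs)
length-filter P? [] = refl
length-filter P? (x ∷ xs) with P? x
... | yes _ = cong suc (length-filter P? xs)
... | no  _ = length-filter P? xs

+m-+n≡+[m∸n] : ∀ {m n} → n ℕ.≤ m → + m - + n ≡ + (m ℕ.∸ n)
+m-+n≡+[m∸n] {m} {n} n≤m = trans (ℤP.m-n≡m⊖n m n) (ℤP.⊖-≥ n≤m)

<∸⇒+< : ∀ {x n o} → x ℕ.< o ℕ.∸ n → x ℕ.+ n ℕ.< o
<∸⇒+< {x} {n} {o} lt with n ℕ.≤? o
... | yes n≤o = ℕP.m≤o∸n⇒m+n≤o (suc x) n≤o lt
... | no  n≰o = ⊥-elim (ℕP.n≮0 (subst (x ℕ.<_) (ℕP.m≤n⇒m∸n≡0 (ℕP.<⇒≤ (ℕP.≰⇒> n≰o))) lt))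

+<⇒<∸ : ∀ {x n o} → x ℕ.+ n ℕ.< o → x ℕ.< o ℕ.∸ n
+<⇒<∸ {x} = ℕP.m+n≤o⇒m≤o∸n (suc x)

m∸n≡1+m∸1+n : ∀ {m n} → suc n ℕ.≤ m → m ℕ.∸ n ≡ suc (m ℕ.∸ suc n)
m∸n≡1+m∸1+n (s≤s n≤m) = ℕP.+-∸-assoc 1 n≤m

<∸-swap : ∀ {d b p} → b ℕ.< d ℕ.∸ p → p ℕ.< d ℕ.∸ b
<∸-swap {d} {b} {p} lt = +<⇒<∸ (subst (ℕ._< d) (ℕP.+-comm b p) (<∸⇒+< lt))

module _ {A : Set} where

  sum-map-cong : ∀ (xs : List A) {f g : A → ℕ} → (∀ x → x ∈ xs → f x ≡ g x) → sum (map f xs) ≡ sum (map g xs)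
  sum-map-cong []       _   = refl
  sum-map-cong (x ∷ xs) f≗g = cong₂ ℕ._+_ (f≗g x (here refl)) (sum-map-cong xs (λ y y∈ → f≗g y (there y∈)))

  sum-map-+ : ∀ (xs : List A) (f g : A → ℕ) → sum (map (λ x → f x ℕ.+ g x) xs) ≡ sum (map f xs) ℕ.+ sum (map g xs)
  sum-map-+ []       f g = refl
  sum-map-+ (x ∷ xs) f g rewrite sum-map-+ xs f g = interchange (f x) (g x) (sum (map f xs)) (sum (map g xs))
    where
    interchange : ∀ a b c d → a ℕ.+ b ℕ.+ (c ℕ.+ d) ≡ a ℕ.+ c ℕ.+ (b ℕ.+ d)
    interchange = ℕ-solve-∀

  sum-map-zero : ∀ (xs : List A) (f : A → ℕ) → (∀ x → x ∈ xs → f x ≡ 0) → sum (map f xs) ≡ 0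
  sum-map-zero xs f f≗0 = trans (sum-map-cong xs f≗0) (sum-replicate-zero xs)
    where
    sum-replicate-zero : ∀ (xs : List A) → sum (map (λ _ → 0) xs) ≡ 0
    sum-replicate-zero []       = refl
    sum-replicate-zero (_ ∷ xs) = sum-replicate-zero xs

  sum-map-*ˡ : ∀ (xs : List A) c (f : A → ℕ) → sum (map (λ x → c ℕ.* f x) xs) ≡ c ℕ.* sum (map f xs)
  sum-map-*ˡ []       c f = sym (ℕP.*-zeroʳ c)
  sum-map-*ˡ (x ∷ xs) c f rewrite sum-map-*ˡ xs c f = sym (ℕP.*-distribˡ-+ c (f x) (sum (map f xs)))

  sum-map-∷ʳ : ∀ (xs : List A) x (f : A → ℕ) → sum (map f (xs ++ x ∷ [])) ≡ sum (map f xs) ℕ.+ f x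
  sum-map-∷ʳ xs x f = trans (cong sum (LP.map-++ f xs (x ∷ [])))
    (trans (sum-++ (map f xs) (f x ∷ [])) (cong (sum (map f xs) ℕ.+_) (ℕP.+-identityʳ (f x))))

sum-map-upTo-suc : ∀ (f : ℕ → ℕ) M → sum (map f (upTo (suc M))) ≡ sum (map f (upTo M)) ℕ.+ f M
sum-map-upTo-suc f M = trans (cong (λ xs → sum (map f xs)) (sym (LP.upTo-∷ʳ M))) (sum-map-∷ʳ (upTo M) M f)

sum-[<?]≡⊓ : ∀ M t → sum (map (λ p → [ p ℕ.<? t ]) (upTo M)) ≡ M ℕ.⊓ t
sum-[<?]≡⊓ zero    t = refl
sum-[<?]≡⊓ (suc M) t rewrite sum-map-upTo-suc (λ p → [ p ℕ.<? t ]) M | sum-[<?]≡⊓ M t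
  with M ℕ.<? t
... | yes M<t = trans (cong (ℕ._+ 1) (ℕP.m≤n⇒m⊓n≡m (ℕP.<⇒≤ M<t))) (trans (ℕP.+-comm M 1) (sym (ℕP.m≤n⇒m⊓n≡m M<t)))
... | no  M≮t = trans (ℕP.+-identityʳ _)
                  (trans (ℕP.m≥n⇒m⊓n≡n (ℕP.≮⇒≥ M≮t)) (sym (ℕP.m≥n⇒m⊓n≡n (ℕP.m≤n⇒m≤1+n (ℕP.≮⇒≥ M≮t)))))

sum-upTo-indicator : ∀ M t (f : ℕ → ℕ) → t ℕ.≤ M → (∀ p → p ℕ.< M → f p ≡ [ p ℕ.<? t ]) → sum (map f (upTo M)) ≡ t
sum-upTo-indicator M t f t≤M f≗ =
  trans (sum-map-cong (upTo M) (λ p p∈ → f≗ p (∈-upTo⁻ p∈))) (trans (sum-[<?]≡⊓ M t) (ℕP.m≥n⇒m⊓n≡n t≤M))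

module _ {A B : Set} where

  sum-map-swap : ∀ (xs : List A) (ys : List B) (f : A → B → ℕ) →
    sum (map (λ x → sum (map (f x) ys)) xs) ≡ sum (map (λ y → sum (map (λ x → f x y) xs)) ys)
  sum-map-swap []       ys f = sym (sum-map-zero ys _ (λ _ _ → refl))
  sum-map-swap (x ∷ xs) ys f rewrite sum-map-swap xs ys f = sym (sum-map-+ ys (f x) (λ y → sum (map (λ x → f x y) xs)))

  sum-map-concatMap : ∀ (xs : List A) (g : A → List B) (f : B → ℕ) →
    sum (map f (concatMap g xs)) ≡ sum (map (λ x → sum (map f (g x))) xs)
  sum-map-concatMap []       g f = refl
  sum-map-concatMap (x ∷ xs) g f = trans (cong sum (LP.map-++ f (g x) (concatMap g xs)))
    (trans (sum-++ (map f (g x)) (map f (concatMap g xs))) (cong (sum (map f (g x)) ℕ.+_) (sum-map-concatMap xs g f)))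

module _ {A : Set} (_≟_ : (x y : A) → Dec (x ≡ y)) where

  sum-select-∉ : ∀ (xs : List A) x₀ (f : A → ℕ) → ¬ (x₀ ∈ xs) → sum (map (λ x → [ x ≟ x₀ ] ℕ.* f x) xs) ≡ 0
  sum-select-∉ xs x₀ f x₀∉ = sum-map-zero xs _ (λ x x∈ → cong (ℕ._* f x) ([ x ≟ x₀ ]-no (λ { refl → x₀∉ x∈ })))

  sum-select : ∀ (xs : List A) x₀ (f : A → ℕ) → Unique xs → x₀ ∈ xs → sum (map (λ x → [ x ≟ x₀ ] ℕ.* f x) xs) ≡ f x₀
  sum-select (x ∷ xs) x₀ f (x∉ ∷ _) (here refl)
    rewrite [ x ≟ x ]-yes refl | sum-select-∉ xs x f (λ x∈ → All.lookup x∉ x∈ refl) =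
    trans (ℕP.+-identityʳ _) (ℕP.+-identityʳ _)
  sum-select (x ∷ xs) x₀ f (x∉ ∷ u) (there x₀∈) rewrite [ x ≟ x₀ ]-no (All.lookup x∉ x₀∈) = sum-select xs x₀ f u x₀∈

interval-suc : ∀ a m → interval a (suc m) ≡ interval a m ++ (a + + m) ∷ []
interval-suc a zero    = cong (_∷ []) (sym (ℤP.+-identityʳ a))
interval-suc a (suc m) =
  cong (a ∷_) (trans (interval-suc (a + 1ℤ) m) (cong (λ z → interval (a + 1ℤ) m ++ z ∷ []) (ℤP.+-assoc a 1ℤ (+ m))))

map-interval-shift : ∀ (g : ℤ → ℕ) a m → map (λ k → g (k + 1ℤ)) (interval a m) ≡ map g (interval (a + 1ℤ) m)
map-interval-shift g a zero    = refl
map-interval-shift g a (suc m) = cong (g (a + 1ℤ) ∷_) (map-interval-shift g (a + 1ℤ) m)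

sum-interval-shift : ∀ (g : ℤ → ℕ) a m → g a ≡ 0 → g (a + + m) ≡ 0 →
  sum (map g (interval a m)) ≡ sum (map g (interval (a + 1ℤ) m))
sum-interval-shift g a zero    _   _   = refl
sum-interval-shift g a (suc m) g[a] g[a+m] = begin
    g a ℕ.+ S                                   ≡⟨ cong (ℕ._+ S) g[a] ⟩
    S                                           ≡⟨ sym (ℕP.+-identityʳ S) ⟩
    S ℕ.+ 0                                     ≡⟨ cong (S ℕ.+_) (sym (trans (cong g (ℤP.+-assoc a 1ℤ (+ m))) g[a+m])) ⟩
    S ℕ.+ g (a + 1ℤ + + m)                      ≡⟨ sym (sum-map-∷ʳ (interval (a + 1ℤ) m) _ g) ⟩
    sum (map g (interval (a + 1ℤ) m ++ (a + 1ℤ + + m) ∷ []))  ≡⟨ cong (λ xs → sum (map g xs)) (sym (interval-suc (a + 1ℤ) m)) ⟩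
    sum (map g (interval (a + 1ℤ) (suc m)))     ∎
  where
  open ≡-Reasoning
  S : ℕ
  S = sum (map g (interval (a + 1ℤ) m))

∈-flatten⁻ : ∀ {y} (P : List (ℤ × ℤ)) → y ∈ flatten P → ∃[ c ] (c ∈ P × (y ≡ proj₁ c ⊎ y ≡ proj₂ c))
∈-flatten⁻ (c ∷ P) (here refl)         = c , here refl , inj₁ refl
∈-flatten⁻ (c ∷ P) (there (here refl)) = c , here refl , inj₂ refl
∈-flatten⁻ (c ∷ P) (there (there y∈))  with ∈-flatten⁻ P y∈
... | c′ , c′∈ , y≡ = c′ , there c′∈ , y≡

∈-flatten⁺ˡ : ∀ {c} {P : List (ℤ × ℤ)} → c ∈ P → proj₁ c ∈ flatten P
∈-flatten⁺ˡ (here refl) = here refl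
∈-flatten⁺ˡ (there c∈)  = there (there (∈-flatten⁺ˡ c∈))

∈-flatten⁺ʳ : ∀ {c} {P : List (ℤ × ℤ)} → c ∈ P → proj₂ c ∈ flatten P
∈-flatten⁺ʳ (here refl) = there (here refl)
∈-flatten⁺ʳ (there c∈)  = there (there (∈-flatten⁺ʳ c∈))

proj₁-injective-on : ∀ {P : List (ℤ × ℤ)} → Unique (flatten P) →
  ∀ {a b} → a ∈ P → b ∈ P → proj₁ a ≡ proj₁ b → a ≡ b
proj₁-injective-on _                  (here refl) (here refl) _ = refl
proj₁-injective-on ((_ ∷ a∉) ∷ _)     (here refl) (there b∈)  e = ⊥-elim (All.lookup a∉ (∈-flatten⁺ˡ b∈) e)
proj₁-injective-on ((_ ∷ b∉) ∷ _)     (there a∈)  (here refl) e = ⊥-elim (All.lookup b∉ (∈-flatten⁺ˡ a∈) (sym e))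
proj₁-injective-on (_ ∷ _ ∷ u)        (there a∈)  (there b∈)  e = proj₁-injective-on u a∈ b∈ e

unique-flatten⇒unique-proj₁ : ∀ {P : List (ℤ × ℤ)} → Unique (flatten P) → Unique (map proj₁ P)
unique-flatten⇒unique-proj₁ {[]}    _ = []
unique-flatten⇒unique-proj₁ {c ∷ P} ((_ ∷ c∉) ∷ _ ∷ u) =
  All.tabulate (λ y∈ → let (d , d∈ , y≡) = ∈-map⁻ proj₁ y∈ in
                        subst (proj₁ c ≢_) (sym y≡) (All.lookup c∉ (∈-flatten⁺ˡ d∈)))
  ∷ unique-flatten⇒unique-proj₁ u

unique-flatten⇒unique-proj₂ : ∀ {P : List (ℤ × ℤ)} → Unique (flatten P) → Unique (map proj₂ P)
unique-flatten⇒unique-proj₂ {[]}    _ = []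
unique-flatten⇒unique-proj₂ {c ∷ P} (_ ∷ c∉ ∷ u) =
  All.tabulate (λ y∈ → let (d , d∈ , y≡) = ∈-map⁻ proj₂ y∈ in
                        subst (proj₂ c ≢_) (sym y≡) (All.lookup c∉ (∈-flatten⁺ʳ d∈)))
  ∷ unique-flatten⇒unique-proj₂ u

NonCrossing : List (ℤ × ℤ) → Set
NonCrossing P = ∀ {a b} → a ∈ P → b ∈ P → ¬ (proj₁ a < proj₁ b × proj₁ b < proj₂ a × proj₂ a < proj₂ b)

-- The matching attached to a lattice path h with steps 0, ±1 that starts and ends at
-- height 0: an up step u (from height t to t + 1) is paired with the first later step v
-- at which the path comes back down to height t.
module FirstReturnMatching
  (h : ℤ → ℕ) (a : ℤ) (n : ℕ)
  (rise≤1 : ∀ k → h k ℕ.≤ suc (h (k - 1ℤ)))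
  (fall≤1 : ∀ k → h (k - 1ℤ) ℕ.≤ suc (h k))
  (flat-outside : ∀ k → k < a ⊎ a + + n ≤ k → h k ≡ h (k - 1ℤ))
  (h-start : h (a - 1ℤ) ≡ 0)
  (h-end : h (a + + n - 1ℤ) ≡ 0)
  (q : ℤ → Snake)
  (L⇒up : ∀ k t → q k ≡ L t → h (k - 1ℤ) ≡ t × h k ≡ suc t)
  (R⇒down : ∀ k t → q k ≡ R t → h k ≡ t × h (k - 1ℤ) ≡ suc t)
  (up⇒L : ∀ k → h k ≡ suc (h (k - 1ℤ)) → q k ≡ L (h (k - 1ℤ)))
  (down⇒R : ∀ k → h (k - 1ℤ) ≡ suc (h k) → q k ≡ R (h k))
  where

  Up Down : ℤ → Set
  Up k   = h k ≡ suc (h (k - 1ℤ))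
  Down k = h (k - 1ℤ) ≡ suc (h k)

  up? : ∀ k → Dec (Up k)
  up? k = h k ℕP.≟ suc (h (k - 1ℤ))

  down? : ∀ k → Dec (Down k)
  down? k = h (k - 1ℤ) ℕP.≟ suc (h k)

  window : List ℤ
  window = interval a n

  ups downs : List ℤ
  ups   = filter up? window
  downs = filter down? window

  up∧down⇒⊥ : ∀ {k} → Up k → Down k → ⊥
  up∧down⇒⊥ {k} u d = ℕP.<-asym (subst (h (k - 1ℤ) ℕ.<_) (sym u) (ℕP.n<1+n _)) (subst (h k ℕ.<_) (sym d) (ℕP.n<1+n _))

  level : ∀ {k} → ¬ Up k → ¬ Down k → h k ≡ h (k - 1ℤ)
  level {k} ¬u ¬d with ℕP.<-cmp (h k) (h (k - 1ℤ))
  ... | tri< lt _ _ = ⊥-elim (¬d (ℕP.≤-antisym (fall≤1 k) lt))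
  ... | tri≈ _ e _  = e
  ... | tri> _ _ gt = ⊥-elim (¬u (ℕP.≤-antisym (rise≤1 k) gt))

  moves⇒∈window : ∀ {k} → h k ≢ h (k - 1ℤ) → k ∈ window
  moves⇒∈window {k} moves with a ℤ.≤? k | k ℤ.<? a + + n
  ... | yes a≤k | yes k<a+n = ∈-interval⁺ a≤k k<a+n
  ... | no  a≰k | _         = ⊥-elim (moves (flat-outside k (inj₁ (ℤP.≰⇒> a≰k))))
  ... | yes _   | no  k≮a+n = ⊥-elim (moves (flat-outside k (inj₂ (ℤP.≮⇒≥ k≮a+n))))

  up⇒∈window : ∀ {k} → Up k → k ∈ window
  up⇒∈window u = moves⇒∈window (λ e → ℕP.1+n≢n (sym (trans (sym e) u)))

  up⇒∈ups : ∀ {k} → Up k → k ∈ ups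
  up⇒∈ups u = ∈-filter⁺ up? (up⇒∈window u) u

  down⇒∈downs : ∀ {k} → Down k → k ∈ downs
  down⇒∈downs d = ∈-filter⁺ down? (moves⇒∈window (λ e → ℕP.1+n≢n (sym (trans e d)))) d

  ∈ups⇒up : ∀ {k} → k ∈ ups → Up k
  ∈ups⇒up k∈ = proj₂ (∈-filter⁻ up? {xs = window} k∈)

  step-balance : ∀ k → [ up? k ] ℕ.+ h (k - 1ℤ) ≡ [ down? k ] ℕ.+ h k
  step-balance k with up? k | down? k
  ... | yes u | yes d = ⊥-elim (up∧down⇒⊥ u d)
  ... | yes u | no  _ = sym u
  ... | no  _ | yes d = d
  ... | no ¬u | no ¬d = sym (level ¬u ¬d)

  balance : ∀ b m → sum (map (λ k → [ up? k ]) (interval b m)) ℕ.+ h (b - 1ℤ)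
                  ≡ sum (map (λ k → [ down? k ]) (interval b m)) ℕ.+ h (b + + m - 1ℤ)
  balance b zero    = cong (λ x → h (x - 1ℤ)) (sym (ℤP.+-identityʳ b))
  balance b (suc m) = begin
      [ up? b ] ℕ.+ U ℕ.+ h (b - 1ℤ)                  ≡⟨ swap [ up? b ] U _ ⟩
      U ℕ.+ ([ up? b ] ℕ.+ h (b - 1ℤ))                ≡⟨ cong (U ℕ.+_) (step-balance b) ⟩
      U ℕ.+ ([ down? b ] ℕ.+ h b)                     ≡⟨ swap′ U [ down? b ] (h b) ⟩
      [ down? b ] ℕ.+ (U ℕ.+ h b)                     ≡⟨ cong (λ x → [ down? b ] ℕ.+ (U ℕ.+ h x)) (sym (i+1-1≡i b)) ⟩
      [ down? b ] ℕ.+ (U ℕ.+ h (b + 1ℤ - 1ℤ))         ≡⟨ cong ([ down? b ] ℕ.+_) (balance (b + 1ℤ) m) ⟩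
      [ down? b ] ℕ.+ (D ℕ.+ h (b + 1ℤ + + m - 1ℤ))   ≡⟨ cong (λ x → [ down? b ] ℕ.+ (D ℕ.+ h (x - 1ℤ))) (ℤP.+-assoc b 1ℤ (+ m)) ⟩
      [ down? b ] ℕ.+ (D ℕ.+ h (b + + suc m - 1ℤ))    ≡⟨ sym (ℕP.+-assoc [ down? b ] D _) ⟩
      [ down? b ] ℕ.+ D ℕ.+ h (b + + suc m - 1ℤ)      ∎
    where
    open ≡-Reasoning
    U D : ℕ
    U = sum (map (λ k → [ up? k ]) (interval (b + 1ℤ) m))
    D = sum (map (λ k → [ down? k ]) (interval (b + 1ℤ) m))
    swap : ∀ x y z → x ℕ.+ y ℕ.+ z ≡ y ℕ.+ (x ℕ.+ z)
    swap = ℕ-solve-∀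
    swap′ : ∀ x y z → x ℕ.+ (y ℕ.+ z) ≡ y ℕ.+ (x ℕ.+ z)
    swap′ = ℕ-solve-∀

  #downs≡#ups : length downs ≡ length ups
  #downs≡#ups = begin
    length downs                                     ≡⟨ length-filter down? window ⟩
    sum (map (λ k → [ down? k ]) window)             ≡⟨ sym (ℕP.+-identityʳ _) ⟩
    sum (map (λ k → [ down? k ]) window) ℕ.+ 0       ≡⟨ cong (sum (map (λ k → [ down? k ]) window) ℕ.+_) (sym h-end) ⟩
    sum (map (λ k → [ down? k ]) window) ℕ.+ h (a + + n - 1ℤ) ≡⟨ sym (balance a n) ⟩
    sum (map (λ k → [ up? k ]) window) ℕ.+ h (a - 1ℤ) ≡⟨ cong (sum (map (λ k → [ up? k ]) window) ℕ.+_) h-start ⟩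
    sum (map (λ k → [ up? k ]) window) ℕ.+ 0         ≡⟨ ℕP.+-identityʳ _ ⟩
    sum (map (λ k → [ up? k ]) window)               ≡⟨ sym (length-filter up? window) ⟩
    length ups                                       ∎
    where open ≡-Reasoning

  record FirstReturn (u v : ℤ) : Set where
    field
      before      : u < v
      returns     : h v ≡ h (u - 1ℤ)
      stays-above : ∀ w → u ≤ w → w < v → h (u - 1ℤ) ℕ.< h w

  open FirstReturn

  firstReturn⇒down : ∀ {u v} → FirstReturn u v → Down v
  firstReturn⇒down {u} {v} r = ℕP.≤-antisym (fall≤1 v) (begin
      suc (h v)          ≡⟨ cong suc (returns r) ⟩
      suc (h (u - 1ℤ))   ≤⟨ stays-above r (v - 1ℤ) (i<j⇒i≤j-1 (before r)) (i-1<i v) ⟩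
      h (v - 1ℤ)         ∎)
    where open ℕP.≤-Reasoning

  firstReturn-unique : ∀ {u v v′} → FirstReturn u v → FirstReturn u v′ → v ≡ v′
  firstReturn-unique {u} {v} {v′} r r′ with ℤP.<-cmp v v′
  ... | tri< v<v′ _ _ = ⊥-elim (ℕP.<-irrefl (sym (returns r)) (stays-above r′ v (ℤP.<⇒≤ (before r)) v<v′))
  ... | tri≈ _ v≡v′ _ = v≡v′
  ... | tri> _ _ v′<v = ⊥-elim (ℕP.<-irrefl (sym (returns r′)) (stays-above r v′ (ℤP.<⇒≤ (before r′)) v′<v))

  -- u′ - 1 lies inside the excursion from u to v, which stays above its base height h v.
  nested-return⇒⊥ : ∀ {u u′ v} → u < u′ → u′ < v → FirstReturn u v → h (u′ - 1ℤ) ≡ h v → ⊥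
  nested-return⇒⊥ {u} {u′} u<u′ u′<v r e =
    ℕP.<-irrefl (trans (sym (returns r)) (sym e)) (stays-above r (u′ - 1ℤ) (i<j⇒i≤j-1 u<u′) (ℤP.<-trans (i-1<i u′) u′<v))

  firstReturn-injective : ∀ {u u′ v} → FirstReturn u v → FirstReturn u′ v → u ≡ u′
  firstReturn-injective {u} {u′} r r′ with ℤP.<-cmp u u′
  ... | tri< u<u′ _ _ = ⊥-elim (nested-return⇒⊥ u<u′ (before r′) r (sym (returns r′)))
  ... | tri≈ _ u≡u′ _ = u≡u′
  ... | tri> _ _ u′<u = ⊥-elim (nested-return⇒⊥ u′<u (before r) r′ (sym (returns r)))

  -- At the end of the window the path is back at height 0 ≤ h (u - 1).
  firstReturn-exists : ∀ u → Up u → ∃[ v ] FirstReturn u v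
  firstReturn-exists u up with ∈-interval⁻ (up⇒∈window up)
  ... | _ , u<a+n with i≤j⇒∃[d]j≡i+d (i<j⇒i≤j-1 u<a+n)
  ... | D , a+n-1≡u+D with least-witness (λ d → h (u + + d) ℕP.≤? h (u - 1ℤ))
                             (subst (λ x → h x ℕ.≤ h (u - 1ℤ)) a+n-1≡u+D (subst (ℕ._≤ h (u - 1ℤ)) (sym h-end) z≤n))
  ... | zero  , h[u]≤ , _   = ⊥-elim (ℕP.<-irrefl refl (subst (ℕ._≤ h (u - 1ℤ)) (trans (cong h (ℤP.+-identityʳ u)) up) h[u]≤))
  ... | suc d , h[v]≤ , min = u + + suc d , record
    { before      = i+1≤j⇒i<j (ℤP.+-monoʳ-≤ u (+≤+ (s≤s z≤n)))
    ; returns     = ℕP.≤-antisym h[v]≤ (ℕP.≤-pred (ℕP.<-≤-trans h[v-1]> (fall≤1 (u + + suc d))))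
    ; stays-above = above
    }
    where
    v-1≡u+d : u + + suc d - 1ℤ ≡ u + + d
    v-1≡u+d = e u (+ d)
      where
      e : ∀ u x → u + (1ℤ + x) - 1ℤ ≡ u + x
      e = solve-∀
    h[v-1]> : h (u - 1ℤ) ℕ.< h (u + + suc d - 1ℤ)
    h[v-1]> = subst (λ x → h (u - 1ℤ) ℕ.< h x) (sym v-1≡u+d) (ℕP.≰⇒> (min d (ℕP.n<1+n d)))
    above : ∀ w → u ≤ w → w < u + + suc d → h (u - 1ℤ) ℕ.< h w
    above w u≤w w<v with i≤j⇒∃[d]j≡i+d u≤w
    ... | e , refl = ℕP.≰⇒> (min e (ℤP.drop‿+<+ (+-cancelˡ-< u w<v)))

  partner : ℤ → ℤ
  partner u with up? u
  ... | yes up = proj₁ (firstReturn-exists u up)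
  ... | no  _  = u

  partner-firstReturn : ∀ {u} → Up u → FirstReturn u (partner u)
  partner-firstReturn {u} up with up? u
  ... | yes up′ = proj₂ (firstReturn-exists u up′)
  ... | no  ¬up = ⊥-elim (¬up up)

  IsMatching : List (ℤ × ℤ) → Set
  IsMatching P = (length P ≡ length ups)
    × Unique (flatten P)
    × All (λ uv → proj₁ uv < proj₂ uv) P
    × All (λ uv → ∃[ t ] (q (proj₁ uv) ≡ L t × q (proj₂ uv) ≡ R t)) P
    × NonCrossing P

  pairWithPartner : ℤ → ℤ × ℤ
  pairWithPartner u = u , partner u

  matching : List (ℤ × ℤ)
  matching = map pairWithPartner ups

  matching-exists-unique-flatten : ∀ (us : List ℤ) → Unique us → All Up us → Unique (flatten (map pairWithPartner us))
  matching-exists-unique-flatten []       _            _             = []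
  matching-exists-unique-flatten (u ∷ us) (u∉us ∷ uus) (up ∷ ups′) =
    (u≢partner ∷ All.tabulate (λ y∈ → u∉ (∈-flatten⁻ (map pairWithPartner us) y∈)))
    ∷ All.tabulate (λ y∈ → partner∉ (∈-flatten⁻ (map pairWithPartner us) y∈))
    ∷ matching-exists-unique-flatten us uus ups′
    where
    r : FirstReturn u (partner u)
    r = partner-firstReturn up
    u≢partner : u ≢ partner u
    u≢partner e = ℤP.<-irrefl e (before r)
    u∉ : ∀ {y} → ∃[ c ] (c ∈ map pairWithPartner us × (y ≡ proj₁ c ⊎ y ≡ proj₂ c)) → u ≢ y
    u∉ (c , c∈ , y≡) with ∈-map⁻ pairWithPartner c∈
    u∉ (_ , _ , inj₁ refl) | u′ , u′∈ , refl = All.lookup u∉us u′∈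
    u∉ (_ , _ , inj₂ refl) | u′ , u′∈ , refl = λ u≡ →
      up∧down⇒⊥ up (subst Down (sym u≡) (firstReturn⇒down (partner-firstReturn (All.lookup ups′ u′∈))))
    partner∉ : ∀ {y} → ∃[ c ] (c ∈ map pairWithPartner us × (y ≡ proj₁ c ⊎ y ≡ proj₂ c)) → partner u ≢ y
    partner∉ (c , c∈ , y≡) with ∈-map⁻ pairWithPartner c∈
    partner∉ (_ , _ , inj₁ refl) | u′ , u′∈ , refl = λ p≡ →
      up∧down⇒⊥ (All.lookup ups′ u′∈) (subst Down p≡ (firstReturn⇒down r))
    partner∉ (_ , _ , inj₂ refl) | u′ , u′∈ , refl = λ p≡ →
      All.lookup u∉us u′∈ (firstReturn-injective r (subst (FirstReturn u′) (sym p≡) (partner-firstReturn (All.lookup ups′ u′∈))))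

  matching-isMatching : IsMatching matching
  matching-isMatching =
      LP.length-map pairWithPartner ups
    , matching-exists-unique-flatten ups (UniqueP.filter⁺ up? (interval-unique a n)) (All.tabulate ∈ups⇒up)
    , All.tabulate (onPairs (λ u up → before (partner-firstReturn up)))
    , All.tabulate (onPairs labels)
    , noncrossing
    where
    onPairs : ∀ {Q : ℤ × ℤ → Set} → (∀ u → Up u → Q (u , partner u)) → ∀ {c} → c ∈ matching → Q c
    onPairs f c∈ with ∈-map⁻ pairWithPartner c∈
    ... | u , u∈ , refl = f u (∈ups⇒up u∈)
    labels : ∀ u → Up u → ∃[ t ] (q u ≡ L t × q (partner u) ≡ R t)
    labels u up = h (u - 1ℤ) , up⇒L u up ,
      subst (λ t → q (partner u) ≡ R t) (returns (partner-firstReturn up)) (down⇒R _ (firstReturn⇒down (partner-firstReturn up)))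
    noncrossing : NonCrossing matching
    noncrossing a∈ b∈ (u<u′ , u′<v , v<v′) with ∈-map⁻ pairWithPartner a∈ | ∈-map⁻ pairWithPartner b∈
    ... | u , u∈ , refl | u′ , u′∈ , refl =
      ℕP.<-asym (stays-above r (u′ - 1ℤ) (i<j⇒i≤j-1 u<u′) (ℤP.<-trans (i-1<i u′) u′<v))
                (subst (h (u′ - 1ℤ) ℕ.<_) (returns r) (stays-above r′ (partner u) (ℤP.<⇒≤ u′<v) v<v′))
      where
      r : FirstReturn u (partner u)
      r = partner-firstReturn (∈ups⇒up u∈)
      r′ : FirstReturn u′ (partner u′)
      r′ = partner-firstReturn (∈ups⇒up u′∈)

  module _ (P : List (ℤ × ℤ)) (P-matching : IsMatching P) where

    private
      #P≡#ups : length P ≡ length ups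
      #P≡#ups = proj₁ P-matching
      uP : Unique (flatten P)
      uP = proj₁ (proj₂ P-matching)
      ordered : All (λ uv → proj₁ uv < proj₂ uv) P
      ordered = proj₁ (proj₂ (proj₂ P-matching))
      labelled : All (λ uv → ∃[ t ] (q (proj₁ uv) ≡ L t × q (proj₂ uv) ≡ R t)) P
      labelled = proj₁ (proj₂ (proj₂ (proj₂ P-matching)))
      noncrossing : NonCrossing P
      noncrossing = proj₂ (proj₂ (proj₂ (proj₂ P-matching)))

    pair-steps : ∀ {c} → c ∈ P → Up (proj₁ c) × Down (proj₂ c) × h (proj₂ c) ≡ h (proj₁ c - 1ℤ)
    pair-steps c∈ with All.lookup labelled c∈
    ... | t , qu≡Lt , qv≡Rt with L⇒up _ t qu≡Lt | R⇒down _ t qv≡Rt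
    ...   | h[u-1]≡t , h[u]≡1+t | h[v]≡t , h[v-1]≡1+t =
      trans h[u]≡1+t (cong suc (sym h[u-1]≡t)) , trans h[v-1]≡1+t (cong suc (sym h[v]≡t)) , trans h[v]≡t (sym h[u-1]≡t)

    -- Pigeonhole: the left ends of P are length ups distinct up steps, and the right ends
    -- are length downs = length ups distinct down steps.
    ups⊆lefts : ∀ {u} → u ∈ ups → u ∈ map proj₁ P
    ups⊆lefts = unique-⊆-length-≥⇒⊇ ℤ._≟_ (unique-flatten⇒unique-proj₁ uP) lefts⊆ups
      (ℕP.≤-reflexive (sym (trans (LP.length-map proj₁ P) #P≡#ups)))
      where
      lefts⊆ups : ∀ {x} → x ∈ map proj₁ P → x ∈ ups
      lefts⊆ups x∈ with ∈-map⁻ proj₁ x∈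
      ... | c , c∈ , refl = up⇒∈ups (proj₁ (pair-steps c∈))

    downs⊆rights : ∀ {v} → v ∈ downs → v ∈ map proj₂ P
    downs⊆rights = unique-⊆-length-≥⇒⊇ ℤ._≟_ (unique-flatten⇒unique-proj₂ uP) rights⊆downs
      (ℕP.≤-reflexive (sym (trans (LP.length-map proj₂ P) (trans #P≡#ups (sym #downs≡#ups)))))
      where
      rights⊆downs : ∀ {x} → x ∈ map proj₂ P → x ∈ downs
      rights⊆downs x∈ with ∈-map⁻ proj₂ x∈
      ... | c , c∈ , refl = down⇒∈downs (proj₁ (proj₂ (pair-steps c∈)))

    -- A pair (u, v) of P ending after the first return p of u would force the pair ending
    -- at p to cross it or to start strictly inside the excursion from u to p.
    pair-firstReturn : ∀ {c} → c ∈ P → FirstReturn (proj₁ c) (proj₂ c)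
    pair-firstReturn {u , v} c∈ with pair-steps c∈
    ... | up , _ , h[v]≡ with ℤP.<-cmp v (partner u)
    ...   | tri< v<p _ _ = ⊥-elim (ℕP.<-irrefl (sym h[v]≡) (stays-above (partner-firstReturn up) v (ℤP.<⇒≤ (All.lookup ordered c∈)) v<p))
    ...   | tri≈ _ v≡p _ = subst (FirstReturn u) (sym v≡p) (partner-firstReturn up)
    ...   | tri> _ _ p<v with ∈-map⁻ proj₂ (downs⊆rights (down⇒∈downs (firstReturn⇒down (partner-firstReturn up))))
    ...     | (u′ , _) , c′∈ , refl with ℤP.<-cmp u′ u
    ...       | tri< u′<u _ _ = ⊥-elim (noncrossing c′∈ c∈ (u′<u , before (partner-firstReturn up) , p<v))
    ...       | tri≈ _ u′≡u _ = ⊥-elim (ℤP.<-irrefl (cong proj₂ (proj₁-injective-on uP c′∈ c∈ u′≡u)) p<v)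
    ...       | tri> _ _ u<u′ = ⊥-elim (nested-return⇒⊥ u<u′ (All.lookup ordered c′∈) (partner-firstReturn up)
                                          (sym (proj₂ (proj₂ (pair-steps c′∈)))))

    ∈⇔∈matching : ∀ c → c ∈ P ⇔ c ∈ matching
    ∈⇔∈matching c = mk⇔ to from
      where
      to : c ∈ P → c ∈ matching
      to c∈ = subst (_∈ matching) (cong (proj₁ c ,_) (firstReturn-unique (partner-firstReturn up) (pair-firstReturn c∈)))
                (∈-map⁺ pairWithPartner (up⇒∈ups up))
        where
        up : Up (proj₁ c)
        up = proj₁ (pair-steps c∈)
      from : c ∈ matching → c ∈ P
      from c∈ with ∈-map⁻ pairWithPartner c∈
      ... | u , u∈ , refl with ∈-map⁻ proj₁ (ups⊆lefts u∈)
      ...   | c′ , c′∈ , refl =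
        subst (_∈ P) (cong (proj₁ c′ ,_) (firstReturn-unique (pair-firstReturn c′∈) (partner-firstReturn (∈ups⇒up u∈)))) c′∈

  matching-exists-unique : ∃[ P ] (IsMatching P × ((P′ : List (ℤ × ℤ)) → IsMatching P′ → (x : ℤ × ℤ) → (x ∈ P′ ⇔ x ∈ P)))
  matching-exists-unique = matching , matching-isMatching , ∈⇔∈matching

part-antitone : ∀ {α} → IsPartition α → ∀ r → part α (suc (suc r)) ℕ.≤ part α (suc r)
part-antitone []         r       = z≤n
part-antitone [-]        zero    = z≤n
part-antitone [-]        (suc r) = z≤n
part-antitone (x≥y ∷ _)  zero    = x≥y
part-antitone (_ ∷ pα)   (suc r) = part-antitone pα r

part≤part₁ : ∀ {α} → IsPartition α → ∀ r → part α r ℕ.≤ part α 1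
part≤part₁ {[]}    _  zero          = z≤n
part≤part₁ {_ ∷ _} _  zero          = z≤n
part≤part₁         _  (suc zero)    = ℕP.≤-refl
part≤part₁         pα (suc (suc r)) = ℕP.≤-trans (part-antitone pα r) (part≤part₁ pα (suc r))

part-beyond-length : ∀ α r → length α ℕ.< r → part α r ≡ 0
part-beyond-length []      r             _         = refl
part-beyond-length (x ∷ α) (suc zero)    (s≤s ())
part-beyond-length (x ∷ α) (suc (suc r)) (s≤s lt)  = part-beyond-length α (suc r) lt

part-positive⇒≤length : ∀ α r → 0 ℕ.< part α r → r ℕ.≤ length α
part-positive⇒≤length α r pos with length α ℕ.<? r
... | yes lt = ⊥-elim (ℕP.<-irrefl (sym (part-beyond-length α r lt)) pos)
... | no ¬lt = ℕP.≮⇒≥ ¬lt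

∈-range⁻ : ∀ {r M} → r ∈ range M → 1 ℕ.≤ r × r ℕ.≤ M
∈-range⁻ r∈ with ∈-map⁻ suc r∈
... | _ , x∈ , refl = s≤s z≤n , ∈-upTo⁻ x∈

∈-range⁺ : ∀ {r M} → 1 ℕ.≤ r → r ℕ.≤ M → r ∈ range M
∈-range⁺ {suc r} _ r≤M = ∈-map⁺ suc (∈-upTo⁺ r≤M)

range-unique : ∀ M → Unique (range M)
range-unique M = UniqueP.map⁺ ℕP.suc-injective (UniqueP.upTo⁺ M)

range-suc : ∀ M → range (suc M) ≡ range M ++ (suc M ∷ [])
range-suc M = trans (cong (map suc) (sym (LP.upTo-∷ʳ M))) (LP.map-++ suc (upTo M) (M ∷ []))

module DownwardClosed {P : ℕ → Set} (P? : Decidable P) (closed : ∀ r → P (suc (suc r)) → P (suc r)) where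

  closed* : ∀ {r} s → 1 ℕ.≤ r → r ℕ.≤ s → P s → P r
  closed* {r} s 1≤r r≤s ps with ℕP.m≤n⇒m<n∨m≡n r≤s
  ... | inj₂ refl = ps
  closed* (suc zero)    1≤r _ _  | inj₁ (s≤s r<1)  = ⊥-elim (ℕP.<-irrefl refl (ℕP.≤-trans 1≤r r<1))
  closed* (suc (suc s)) 1≤r _ ps | inj₁ (s≤s r≤s′) = closed* (suc s) 1≤r r≤s′ (closed s ps)

  count : ℕ → ℕ
  count M = length (filter P? (range M))

  count-suc : ∀ M → count (suc M) ≡ count M ℕ.+ length (filter P? (suc M ∷ []))
  count-suc M = trans (cong (λ xs → length (filter P? xs)) (range-suc M))
    (trans (cong length (LP.filter-++ P? (range M) (suc M ∷ []))) (LP.length-++ (filter P? (range M))))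

  count-spec : ∀ M → count M ℕ.≤ M
                   × (∀ r → 1 ℕ.≤ r → r ℕ.≤ M → P r → r ℕ.≤ count M)
                   × (∀ r → 1 ℕ.≤ r → r ℕ.≤ count M → P r)
  count-spec zero = z≤n , (λ r 1≤r r≤0 _ → ⊥-elim (ℕP.<-irrefl refl (ℕP.≤-trans 1≤r r≤0)))
                        , (λ r 1≤r r≤0 → ⊥-elim (ℕP.<-irrefl refl (ℕP.≤-trans 1≤r r≤0)))
  count-spec (suc M) with count-spec M | P? (suc M) | count-suc M
  ... | (bound , complete , sound) | yes p | count≡ = ℕP.≤-reflexive all , (λ r _ r≤ _ → subst (r ℕ.≤_) (sym all) r≤)
                                                    , λ r 1≤r r≤ → closed* (suc M) 1≤r (subst (r ℕ.≤_) all r≤) p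
    where
    all-below : ∀ M → count M ℕ.≤ M → (∀ r → 1 ℕ.≤ r → r ℕ.≤ M → P r → r ℕ.≤ count M) → P (suc M) → count M ≡ M
    all-below zero    bound _        _ = ℕP.n≤0⇒n≡0 bound
    all-below (suc M) bound complete p =
      ℕP.≤-antisym bound (complete (suc M) (s≤s z≤n) ℕP.≤-refl (closed* (suc (suc M)) (s≤s z≤n) (ℕP.n≤1+n _) p))
    all : count (suc M) ≡ suc M
    all = trans count≡ (trans (cong (ℕ._+ 1) (all-below M bound complete p)) (ℕP.+-comm M 1))
  ... | (bound , complete , sound) | no ¬p | count≡ =
      subst (ℕ._≤ suc M) (sym same) (ℕP.m≤n⇒m≤1+n bound) , complete′ , λ r 1≤r r≤ → sound r 1≤r (subst (r ℕ.≤_) same r≤)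
    where
    same : count (suc M) ≡ count M
    same = trans count≡ (ℕP.+-identityʳ _)
    complete′ : ∀ r → 1 ℕ.≤ r → r ℕ.≤ suc M → P r → r ℕ.≤ count (suc M)
    complete′ r 1≤r r≤ pr with ℕP.m≤n⇒m<n∨m≡n r≤
    ... | inj₂ refl      = ⊥-elim (¬p pr)
    ... | inj₁ (s≤s r≤M) = subst (r ℕ.≤_) (sym same) (complete r 1≤r r≤M pr)

-- The vertical step of the boundary path in row r has index lastContent α r, and the
-- horizontal step of index k lies in row depth α k (this is the row used by stepAt).
lastContent : List ℕ → ℕ → ℤ
lastContent α r = + part α r - + r

depth : List ℕ → ℤ → ℕ
depth α k = length (filter (λ r → k ℤ.<? lastContent α r) (searchRows α k))

lastContent-decreasing : ∀ {α} → IsPartition α → ∀ r → lastContent α (suc (suc r)) + 1ℤ ≤ lastContent α (suc r)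
lastContent-decreasing {α} pα r = subst (_≤ lastContent α (suc r)) (sym (e (+ part α (suc (suc r))) (+ suc r)))
  (ℤP.+-monoˡ-≤ (- (+ suc r)) (+≤+ (part-antitone pα r)))
  where
  e : ∀ p s → p - (1ℤ + s) + 1ℤ ≡ p - s
  e = solve-∀

lastContent-beyond-length : ∀ α r → length α ℕ.< r → lastContent α r ≡ - (+ r)
lastContent-beyond-length α r lt = trans (cong (λ p → + p - + r) (part-beyond-length α r lt)) (ℤP.+-identityˡ (- (+ r)))

∣k∣<r⇒k≮-r : ∀ k r → ∣ k ∣ ℕ.< r → ¬ (k < - (+ r))
∣k∣<r⇒k≮-r (+ n)    r _  k<-r = ℤP.<-irrefl refl (ℤP.<-≤-trans k<-r (ℤP.≤-trans (ℤP.neg-mono-≤ (+≤+ z≤n)) (+≤+ z≤n)))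
∣k∣<r⇒k≮-r -[1+ n ] r lt k<-r =
  ℕP.<-asym lt (ℤP.drop‿+<+ (subst (_< + suc n) (ℤP.neg-involutive (+ r)) (ℤP.neg-mono-< k<-r)))

y≤v⇒K<v-c : ∀ {K y c v} → K ≡ y - + c - 1ℤ → y ≤ + v → K < + v - + c
y≤v⇒K<v-c {y = y} {c} {v} refl y≤v =
  i+1≤j⇒i<j (subst (_≤ + v - + c) (sym (i-1+1≡i (y - + c))) (ℤP.+-monoˡ-≤ (- (+ c)) y≤v))

K<v-c⇒y≤v : ∀ {K y c v} → K ≡ y - + c - 1ℤ → K < + v - + c → y ≤ + v
K<v-c⇒y≤v {y = y} {c} {v} refl K<v-c = subst₂ _≤_ (e′ y (+ c)) (e′ (+ v) (+ c))
  (ℤP.+-monoˡ-≤ (+ c) (subst (_≤ + v - + c) (i-1+1≡i (y - + c)) (i<j⇒i+1≤j K<v-c)))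
  where
  e′ : ∀ y c → y - c + c ≡ y
  e′ = solve-∀

module Depth {α : List ℕ} (pα : IsPartition α) where

  private
    module Count (k : ℤ) = DownwardClosed (λ r → k ℤ.<? lastContent α r)
      (λ r p → ℤP.<-trans p (i+1≤j⇒i<j (lastContent-decreasing pα r)))

    beyond-search : ∀ k r → length α ℕ.+ ∣ k ∣ ℕ.< r → ¬ (k < lastContent α r)
    beyond-search k r lt k< = ∣k∣<r⇒k≮-r k r (ℕP.≤-<-trans (ℕP.m≤n+m ∣ k ∣ (length α)) lt)
      (subst (k <_) (lastContent-beyond-length α r (ℕP.≤-<-trans (ℕP.m≤m+n (length α) ∣ k ∣) lt)) k<)

  <lastContent⇒≤depth : ∀ k r → 1 ℕ.≤ r → k < lastContent α r → r ℕ.≤ depth α k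
  <lastContent⇒≤depth k r 1≤r k< with r ℕ.≤? length α ℕ.+ ∣ k ∣
  ... | yes r≤ = proj₁ (proj₂ (Count.count-spec k (length α ℕ.+ ∣ k ∣))) r 1≤r r≤ k<
  ... | no  r≰ = ⊥-elim (beyond-search k r (ℕP.≰⇒> r≰) k<)

  ≤depth⇒<lastContent : ∀ k r → 1 ℕ.≤ r → r ℕ.≤ depth α k → k < lastContent α r
  ≤depth⇒<lastContent k = proj₂ (proj₂ (Count.count-spec k (length α ℕ.+ ∣ k ∣)))

  depth<⇒≮lastContent : ∀ k r → 1 ℕ.≤ r → depth α k ℕ.< r → ¬ (k < lastContent α r)
  depth<⇒≮lastContent k r 1≤r lt k< = ℕP.<-irrefl refl (ℕP.<-≤-trans lt (<lastContent⇒≤depth k r 1≤r k<))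

  depth-antitone : ∀ {k k′} → k ≤ k′ → depth α k′ ℕ.≤ depth α k
  depth-antitone {k} {k′} k≤k′ with depth α k′ in eq
  ... | zero  = z≤n
  ... | suc t = <lastContent⇒≤depth k (suc t) (s≤s z≤n)
                  (ℤP.≤-<-trans k≤k′ (≤depth⇒<lastContent k′ (suc t) (s≤s z≤n) (ℕP.≤-reflexive (sym eq))))

  depth≤depth[k-1] : ∀ k → depth α k ℕ.≤ depth α (k - 1ℤ)
  depth≤depth[k-1] k = depth-antitone (ℤP.<⇒≤ (i-1<i k))

  depth[k-1]≤1+depth : ∀ k → depth α (k - 1ℤ) ℕ.≤ suc (depth α k)
  depth[k-1]≤1+depth k with depth α (k - 1ℤ) in eq
  ... | zero        = z≤n
  ... | suc zero    = s≤s z≤n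
  ... | suc (suc s) = s≤s (<lastContent⇒≤depth k (suc s) (s≤s z≤n) (ℤP.<-≤-trans k< (lastContent-decreasing pα s)))
    where
    k< : k < lastContent α (suc (suc s)) + 1ℤ
    k< = subst (_< lastContent α (suc (suc s)) + 1ℤ) (i-1+1≡i k)
           (ℤP.+-monoˡ-< 1ℤ (≤depth⇒<lastContent (k - 1ℤ) (suc (suc s)) (s≤s z≤n) (ℕP.≤-reflexive (sym eq))))

  depth-step : ∀ k → depth α (k - 1ℤ) ≡ depth α k ⊎ depth α (k - 1ℤ) ≡ suc (depth α k)
  depth-step k with ℕP.m≤n⇒m<n∨m≡n (depth[k-1]≤1+depth k)
  ... | inj₂ e  = inj₂ e
  ... | inj₁ lt = inj₁ (ℕP.≤-antisym (ℕP.≤-pred lt) (depth≤depth[k-1] k))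

  vertical⇒ : ∀ k r → 1 ℕ.≤ r → lastContent α r ≡ k → r ≡ suc (depth α k) × depth α (k - 1ℤ) ≡ suc (depth α k)
  vertical⇒ k r 1≤r e = r≡ , ℕP.≤-antisym (depth[k-1]≤1+depth k) (subst (ℕ._≤ depth α (k - 1ℤ)) r≡ r≤)
    where
    r≤ : r ℕ.≤ depth α (k - 1ℤ)
    r≤ = <lastContent⇒≤depth (k - 1ℤ) r 1≤r (subst (k - 1ℤ <_) (sym e) (i-1<i k))
    depth<r : depth α k ℕ.< r
    depth<r with depth α k ℕ.<? r
    ... | yes lt = lt
    ... | no ¬lt = ⊥-elim (ℤP.<-irrefl (sym e) (≤depth⇒<lastContent k r 1≤r (ℕP.≮⇒≥ ¬lt)))
    r≡ : r ≡ suc (depth α k)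
    r≡ = ℕP.≤-antisym (ℕP.≤-trans r≤ (depth[k-1]≤1+depth k)) depth<r

  ≤part⇒≤depth : ∀ {K y c} → K ≡ y - + c - 1ℤ → 1 ℕ.≤ c → y ≤ + part α c → c ℕ.≤ depth α K
  ≤part⇒≤depth {K} {c = c} eK 1≤c y≤ = <lastContent⇒≤depth K c 1≤c (y≤v⇒K<v-c eK y≤)

  ≤depth⇒≤part : ∀ {K y c} → K ≡ y - + c - 1ℤ → 1 ℕ.≤ c → c ℕ.≤ depth α K → y ≤ + part α c
  ≤depth⇒≤part {K} {c = c} eK 1≤c c≤ = K<v-c⇒y≤v eK (≤depth⇒<lastContent K c 1≤c c≤)

  vertical⇐ : ∀ k → depth α (k - 1ℤ) ≡ suc (depth α k) → lastContent α (suc (depth α k)) ≡ k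
  vertical⇐ k e = ℤP.≤-antisym (ℤP.≮⇒≥ (depth<⇒≮lastContent k (suc (depth α k)) (s≤s z≤n) ℕP.≤-refl))
    (subst (_≤ lastContent α (suc (depth α k))) (i-1+1≡i k)
      (i<j⇒i+1≤j (≤depth⇒<lastContent (k - 1ℤ) (suc (depth α k)) (s≤s z≤n) (ℕP.≤-reflexive (sym e)))))

  vertical∈searchRows : ∀ k r → 1 ℕ.≤ r → lastContent α r ≡ k → r ∈ searchRows α k
  vertical∈searchRows k r 1≤r e with r ℕ.≤? length α ℕ.+ ∣ k ∣
  ... | yes r≤ = ∈-range⁺ 1≤r r≤
  ... | no  r≰ = ⊥-elim (ℕP.<-irrefl (trans (cong ∣_∣ (sym -r≡k)) (ℤP.∣-i∣≡∣i∣ (+ r)))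
                                     (ℕP.≤-<-trans (ℕP.m≤n+m ∣ k ∣ (length α)) (ℕP.≰⇒> r≰)))
    where
    -r≡k : - (+ r) ≡ k
    -r≡k = trans (sym (lastContent-beyond-length α r (ℕP.≤-<-trans (ℕP.m≤m+n (length α) ∣ k ∣) (ℕP.≰⇒> r≰)))) e

data StepView (α : List ℕ) (k : ℤ) : Step → Set where
  vertical   : ∀ d → depth α k ≡ d → depth α (k - 1ℤ) ≡ suc d → lastContent α (suc d) ≡ k →
               StepView α k (ver (+ suc d) (+ part α (suc d)))
  horizontal : ∀ d → depth α k ≡ d → depth α (k - 1ℤ) ≡ d → StepView α k (hor (+ d) (k + 1ℤ + + d))

stepView : ∀ {α} → IsPartition α → ∀ k → StepView α k (stepAt α k)
stepView {α} pα k with filter (λ r → (+ part α r - + r) ℤ.≟ k) (searchRows α k) in eq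
... | r ∷ _ with ∈-filter⁻ (λ r → (+ part α r - + r) ℤ.≟ k) {xs = searchRows α k} (subst (r ∈_) (sym eq) (here refl))
...   | r∈ , lastContent≡k with Depth.vertical⇒ pα k r (proj₁ (∈-range⁻ r∈)) lastContent≡k
...     | r≡ , d≡ = subst (λ r → StepView α k (ver (+ r) (+ part α r))) (sym r≡)
                        (vertical (depth α k) refl d≡ (Depth.vertical⇐ pα k d≡))
stepView {α} pα k | [] = horizontal (depth α k) refl d≡
  where
  open Depth pα
  d≡ : depth α (k - 1ℤ) ≡ depth α k
  d≡ with depth-step k
  ... | inj₁ e = e
  ... | inj₂ e with subst (suc (depth α k) ∈_) eq
                   (∈-filter⁺ (λ r → (+ part α r - + r) ℤ.≟ k) (vertical∈searchRows k _ (s≤s z≤n) (vertical⇐ k e)) (vertical⇐ k e))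
  ...   | ()

half-even : ∀ t → half (t ℕ.+ t) ≡ just t
half-even zero    = refl
half-even (suc t) rewrite ℕP.+-suc t t | half-even t = refl

half-odd : ∀ t → half (suc (t ℕ.+ t)) ≡ nothing
half-odd zero    = refl
half-odd (suc t) rewrite ℕP.+-suc t t | half-odd t = refl

snakeOfSize : ℕ → Step → Snake
snakeOfSize zero _ = O
snakeOfSize (suc ℓ) s with half ℓ | s
... | nothing | _       = O
... | just m  | hor _ _ = L m
... | just m  | ver _ _ = R m

module Skew (lam μ : List ℕ) (pλ : IsPartition lam) (pμ : IsPartition μ) (μ⊆λ : μ ⊆ᵖ lam) where

  module Dλ = Depth pλ
  module Dμ = Depth pμ

  -- By inSkew⇒ and inSkew⇐, thickness k is the number of squares of λ/μ of content k + 1.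
  thickness : ℤ → ℕ
  thickness k = depth lam k ℕ.∸ depth μ k

  inSkew⇒ : ∀ {x y K c} → x ≡ + c → K ≡ y - x - 1ℤ → InSkew lam μ x y → depth μ K ℕ.< c × c ℕ.≤ depth lam K
  inSkew⇒ {c = c} refl eK (1≤x , μ<y , y≤λ) =
    ℕP.≰⇒> (λ c≤ → ℤP.<-irrefl refl (ℤP.<-≤-trans μ<y (Dμ.≤depth⇒≤part eK 1≤c c≤))) , Dλ.≤part⇒≤depth eK 1≤c y≤λ
    where
    1≤c : 1 ℕ.≤ c
    1≤c = ℤP.drop‿+≤+ 1≤x

  inSkew⇐ : ∀ {x y K c} → x ≡ + c → K ≡ y - x - 1ℤ → depth μ K ℕ.< c → c ℕ.≤ depth lam K → InSkew lam μ x y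
  inSkew⇐ {c = c} refl eK μ< ≤λ =
    +≤+ 1≤c , ℤP.≰⇒> (λ y≤ → ℕP.<-irrefl refl (ℕP.<-≤-trans μ< (Dμ.≤part⇒≤depth eK 1≤c y≤))) , Dλ.≤depth⇒≤part eK 1≤c ≤λ
    where
    1≤c : 1 ℕ.≤ c
    1≤c = ℕP.≤-trans (s≤s z≤n) μ<

  [inSkew?]≡[<?] : ∀ {x y K d p} → x ≡ + (d ℕ.∸ p) → K ≡ y - x - 1ℤ → depth lam K ≡ d →
                     [ inSkew? lam μ x y ] ≡ [ p ℕ.<? d ℕ.∸ depth μ K ]
  [inSkew?]≡[<?] {d = d} {p} ex eK d≡ = [ inSkew? _ _ _ _ ]-cong (_ ℕ.<? _)
    (λ s → <∸-swap (proj₁ (inSkew⇒ ex eK s)))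
    (λ p< → inSkew⇐ ex eK (<∸-swap p<) (subst (d ℕ.∸ p ℕ.≤_) (sym d≡) (ℕP.m∸n≤m d p)))

  notInSkew-row≤0 : ∀ {x y} → x < 1ℤ → ¬ InSkew lam μ x y
  notInSkew-row≤0 x<1 (1≤x , _) = ℤP.<-irrefl refl (ℤP.<-≤-trans x<1 1≤x)

  -- Below a horizontal step of λ in row d, the squares (d - p, j - p) have content k + 1
  -- and the squares (d - p, j - p - 1) content k, so each row of the staircase counts
  -- one diagonal.
  stairH≡ : ∀ k d → depth lam k ≡ d → depth lam (k - 1ℤ) ≡ d →
            stairH lam μ (+ d) (k + 1ℤ + + d) ≡ thickness (k - 1ℤ) ℕ.+ thickness k
  stairH≡ k d d≡ d[k-1]≡ = begin
      stairH lam μ (+ d) (k + 1ℤ + + d)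
    ≡⟨ sum-map-+ (upTo (suc d)) onDiag onDiag-1 ⟩
      sum (map onDiag (upTo (suc d))) ℕ.+ sum (map onDiag-1 (upTo (suc d)))
    ≡⟨ cong₂ ℕ._+_ (sum-upTo-indicator (suc d) (d ℕ.∸ depth μ k) onDiag (∸≤1+ (depth μ k)) count-k)
                   (sum-upTo-indicator (suc d) (d ℕ.∸ depth μ (k - 1ℤ)) onDiag-1 (∸≤1+ (depth μ (k - 1ℤ))) count-k-1) ⟩
      d ℕ.∸ depth μ k ℕ.+ (d ℕ.∸ depth μ (k - 1ℤ))
    ≡⟨ ℕP.+-comm (d ℕ.∸ depth μ k) _ ⟩
      d ℕ.∸ depth μ (k - 1ℤ) ℕ.+ (d ℕ.∸ depth μ k)
    ≡⟨ cong₂ (λ u v → u ℕ.∸ depth μ (k - 1ℤ) ℕ.+ (v ℕ.∸ depth μ k)) (sym d[k-1]≡) (sym d≡) ⟩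
      thickness (k - 1ℤ) ℕ.+ thickness k
    ∎
    where
    open ≡-Reasoning
    ∸≤1+ : ∀ b → d ℕ.∸ b ℕ.≤ suc d
    ∸≤1+ b = ℕP.≤-trans (ℕP.m∸n≤m d b) (ℕP.n≤1+n d)
    onDiag onDiag-1 : ℕ → ℕ
    onDiag   p = [ inSkew? lam μ (+ d - + p) (k + 1ℤ + + d - + p) ]
    onDiag-1 p = [ inSkew? lam μ (+ d - + p) (k + 1ℤ + + d - + p - 1ℤ) ]
    e : ∀ k d p → k ≡ k + 1ℤ + d - p - (d - p) - 1ℤ
    e = solve-∀
    e₋ : ∀ k d p → k - 1ℤ ≡ k + 1ℤ + d - p - 1ℤ - (d - p) - 1ℤ
    e₋ = solve-∀
    count-k : ∀ p → p ℕ.< suc d → onDiag p ≡ [ p ℕ.<? d ℕ.∸ depth μ k ]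
    count-k p p<1+d = [inSkew?]≡[<?] (+m-+n≡+[m∸n] (ℕP.≤-pred p<1+d)) (e k (+ d) (+ p)) d≡
    count-k-1 : ∀ p → p ℕ.< suc d → onDiag-1 p ≡ [ p ℕ.<? d ℕ.∸ depth μ (k - 1ℤ) ]
    count-k-1 p p<1+d = [inSkew?]≡[<?] (+m-+n≡+[m∸n] (ℕP.≤-pred p<1+d)) (e₋ k (+ d) (+ p)) d[k-1]≡

  stairV≡ : ∀ k d → depth lam k ≡ d → depth lam (k - 1ℤ) ≡ suc d → lastContent lam (suc d) ≡ k →
            stairV lam μ (+ suc d) (+ part lam (suc d)) ≡ thickness (k - 1ℤ) ℕ.+ thickness k
  stairV≡ k d d≡ d[k-1]≡ lastContent≡k = begin
      stairV lam μ (+ suc d) (+ part lam (suc d))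
    ≡⟨ sum-map-+ (upTo (suc (suc d))) onDiag-1 onDiag ⟩
      sum (map onDiag-1 (upTo (suc (suc d)))) ℕ.+ sum (map onDiag (upTo (suc (suc d))))
    ≡⟨ cong₂ ℕ._+_ (sum-upTo-indicator (suc (suc d)) (suc d ℕ.∸ depth μ (k - 1ℤ)) onDiag-1
                      (ℕP.≤-trans (ℕP.m∸n≤m (suc d) (depth μ (k - 1ℤ))) (ℕP.n≤1+n (suc d))) count-k-1)
                   (sum-upTo-indicator (suc (suc d)) (d ℕ.∸ depth μ k) onDiag
                      (ℕP.≤-trans (ℕP.m∸n≤m d (depth μ k)) (ℕP.≤-trans (ℕP.n≤1+n d) (ℕP.n≤1+n (suc d)))) count-k) ⟩
      suc d ℕ.∸ depth μ (k - 1ℤ) ℕ.+ (d ℕ.∸ depth μ k)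
    ≡⟨ cong₂ (λ u v → u ℕ.∸ depth μ (k - 1ℤ) ℕ.+ (v ℕ.∸ depth μ k)) (sym d[k-1]≡) (sym d≡) ⟩
      thickness (k - 1ℤ) ℕ.+ thickness k
    ∎
    where
    open ≡-Reasoning
    c : ℤ
    c = + part lam (suc d)
    onDiag-1 onDiag : ℕ → ℕ
    onDiag-1 p = [ inSkew? lam μ (+ suc d - + p) (c - + p) ]
    onDiag   p = [ inSkew? lam μ (+ suc d - + p - 1ℤ) (c - + p) ]
    e₋ : ∀ c r p → c - p - (r - p) - 1ℤ ≡ (c - r) - 1ℤ
    e₋ = solve-∀
    e : ∀ c r p → c - p - (r - p - 1ℤ) - 1ℤ ≡ c - r
    e = solve-∀
    count-k-1 : ∀ p → p ℕ.< suc (suc d) → onDiag-1 p ≡ [ p ℕ.<? suc d ℕ.∸ depth μ (k - 1ℤ) ]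
    count-k-1 p p<2+d = [inSkew?]≡[<?] (+m-+n≡+[m∸n] (ℕP.≤-pred p<2+d))
      (trans (cong (_- 1ℤ) (sym lastContent≡k)) (sym (e₋ c (+ suc d) (+ p)))) d[k-1]≡
    count-k : ∀ p → p ℕ.< suc (suc d) → onDiag p ≡ [ p ℕ.<? d ℕ.∸ depth μ k ]
    count-k p p<2+d with ℕP.m≤n⇒m<n∨m≡n (ℕP.≤-pred p<2+d)
    ... | inj₁ p<1+d = [inSkew?]≡[<?] (trans (e′ (+ d) (+ p)) (+m-+n≡+[m∸n] (ℕP.≤-pred p<1+d)))
                         (trans (sym lastContent≡k) (sym (e c (+ suc d) (+ p)))) d≡
      where
      e′ : ∀ d p → 1ℤ + d - p - 1ℤ ≡ d - p
      e′ = solve-∀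
    ... | inj₂ refl = trans ([ inSkew? _ _ _ _ ]-no (notInSkew-row≤0 (subst (_< 1ℤ) (sym (r-r-1 (+ suc d))) -<+)))
                        (sym ([ _ ℕ.<? _ ]-no (λ 1+d< → ℕP.<-irrefl refl
                          (ℕP.<-≤-trans 1+d< (ℕP.≤-trans (ℕP.m∸n≤m d (depth μ k)) (ℕP.n≤1+n d))))))
      where
      r-r-1 : ∀ r → r - r - 1ℤ ≡ -[1+ 0 ]
      r-r-1 r = cong (_- 1ℤ) (ℤP.+-inverseʳ r)

  depthμ≤depthλ : ∀ k → depth μ k ℕ.≤ depth lam k
  depthμ≤depthλ k with depth μ k in eq
  ... | zero  = z≤n
  ... | suc t = Dλ.<lastContent⇒≤depth k (suc t) (s≤s z≤n)
                  (ℤP.<-≤-trans (Dμ.≤depth⇒<lastContent k (suc t) (s≤s z≤n) (ℕP.≤-reflexive (sym eq)))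
                                (ℤP.+-monoˡ-≤ (- (+ suc t)) (+≤+ (μ⊆λ (suc t)))))

  stepRow : Step → ℤ
  stepRow (hor i _) = i
  stepRow (ver i _) = i

  sharedStep⇒thin : ∀ k → stepAt lam k ≡ stepAt μ k → thickness (k - 1ℤ) ≡ 0 × thickness k ≡ 0
  sharedStep⇒thin k = shared (stepView pλ k) (stepView pμ k)
    where
    shared : ∀ {s t} → StepView lam k s → StepView μ k t → s ≡ t → thickness (k - 1ℤ) ≡ 0 × thickness k ≡ 0
    shared (vertical a a≡ a₋≡ _) (vertical b b≡ b₋≡ _) e
      rewrite a≡ | a₋≡ | b≡ | b₋≡ | ℕP.suc-injective (ℤP.+-injective (cong stepRow e)) = ℕP.n∸n≡0 (suc b) , ℕP.n∸n≡0 b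
    shared (horizontal a a≡ a₋≡) (horizontal b b≡ b₋≡) e
      rewrite a≡ | a₋≡ | b≡ | b₋≡ | ℤP.+-injective (cong stepRow e) = ℕP.n∸n≡0 b , ℕP.n∸n≡0 b
    shared (vertical _ _ _ _) (horizontal _ _ _) ()
    shared (horizontal _ _ _) (vertical _ _ _ _) ()

  stair : Step → ℕ
  stair (hor i j) = stairH lam μ i j
  stair (ver i j) = stairV lam μ i j

  stair≡ : ∀ k → stair (stepAt lam k) ≡ thickness (k - 1ℤ) ℕ.+ thickness k
  stair≡ k = view (stepView pλ k)
    where
    view : ∀ {s} → StepView lam k s → stair s ≡ thickness (k - 1ℤ) ℕ.+ thickness k
    view (vertical d d≡ d₋≡ c≡) = stairV≡ k d d≡ d₋≡ c≡
    view (horizontal d d≡ d₋≡)  = stairH≡ k d d≡ d₋≡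

  sizeS-shared : ∀ k → stepAt lam k ≡ stepAt μ k → sizeS lam μ k ≡ 0
  sizeS-shared k e with step? (stepAt lam k) (stepAt μ k)
  ... | yes _ = refl
  ... | no ne = ⊥-elim (ne e)

  sizeS-unshared : ∀ k → stepAt lam k ≢ stepAt μ k → sizeS lam μ k ≡ stair (stepAt lam k)
  sizeS-unshared k ne with step? (stepAt lam k) (stepAt μ k)
  ... | yes e = ⊥-elim (ne e)
  ... | no _ with stepAt lam k
  ...   | hor _ _ = refl
  ...   | ver _ _ = refl

  sizeS≡ : ∀ k → sizeS lam μ k ≡ thickness (k - 1ℤ) ℕ.+ thickness k
  sizeS≡ k = decide (step? (stepAt lam k) (stepAt μ k))
    where
    decide : Dec (stepAt lam k ≡ stepAt μ k) → sizeS lam μ k ≡ thickness (k - 1ℤ) ℕ.+ thickness k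
    decide (yes e) = trans (sizeS-shared k e) (sym (cong₂ ℕ._+_ (proj₁ (sharedStep⇒thin k e)) (proj₂ (sharedStep⇒thin k e))))
    decide (no ne) = trans (sizeS-unshared k ne) (stair≡ k)

  snakeSeq≡ : ∀ k → snakeSeq lam μ k ≡ snakeOfSize (thickness (k - 1ℤ) ℕ.+ thickness k) (stepAt lam k)
  snakeSeq≡ k = trans (unfold k) (cong (λ n → snakeOfSize n (stepAt lam k)) (sizeS≡ k))
    where
    unfold : ∀ k → snakeSeq lam μ k ≡ snakeOfSize (sizeS lam μ k) (stepAt lam k)
    unfold k with sizeS lam μ k
    ... | zero = refl
    ... | suc ℓ with half ℓ | stepAt lam k
    ...   | nothing | _       = refl
    ...   | just _  | hor _ _ = refl
    ...   | just _  | ver _ _ = refl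

  data Move (k : ℤ) : Step → Set where
    level : ∀ {s}   → thickness (k - 1ℤ) ≡ thickness k → Move k s
    up    : ∀ {i j} → thickness k ≡ suc (thickness (k - 1ℤ)) → Move k (hor i j)
    down  : ∀ {i j} → thickness (k - 1ℤ) ≡ suc (thickness k) → Move k (ver i j)

  move : ∀ k → Move k (stepAt lam k)
  move k = fromView (stepView pλ k) (Dμ.depth-step k)
    where
    b : ℕ
    b = depth μ k
    thickness[k-1] : ∀ {x y} → depth lam (k - 1ℤ) ≡ x → depth μ (k - 1ℤ) ≡ y → thickness (k - 1ℤ) ≡ x ℕ.∸ y
    thickness[k-1] = cong₂ ℕ._∸_
    thickness[k] : ∀ {x} → depth lam k ≡ x → thickness k ≡ x ℕ.∸ b
    thickness[k] x≡ = cong (ℕ._∸ b) x≡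
    fromView : ∀ {s} → StepView lam k s → depth μ (k - 1ℤ) ≡ b ⊎ depth μ (k - 1ℤ) ≡ suc b → Move k s
    fromView (vertical d d≡ d₋≡ _) (inj₁ b₋≡) = down (begin
      thickness (k - 1ℤ)  ≡⟨ thickness[k-1] d₋≡ b₋≡ ⟩
      suc d ℕ.∸ b         ≡⟨ ℕP.+-∸-assoc 1 (subst (b ℕ.≤_) d≡ (depthμ≤depthλ k)) ⟩
      suc (d ℕ.∸ b)       ≡⟨ cong suc (sym (thickness[k] d≡)) ⟩
      suc (thickness k)   ∎)
      where open ≡-Reasoning
    fromView (vertical d d≡ d₋≡ _) (inj₂ b₋≡) = level (trans (thickness[k-1] d₋≡ b₋≡) (sym (thickness[k] d≡)))
    fromView (horizontal d d≡ d₋≡) (inj₁ b₋≡) = level (trans (thickness[k-1] d₋≡ b₋≡) (sym (thickness[k] d≡)))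
    fromView (horizontal d d≡ d₋≡) (inj₂ b₋≡) = up (begin
      thickness k                    ≡⟨ thickness[k] d≡ ⟩
      d ℕ.∸ b                        ≡⟨ m∸n≡1+m∸1+n (subst₂ ℕ._≤_ b₋≡ d₋≡ (depthμ≤depthλ (k - 1ℤ))) ⟩
      suc (d ℕ.∸ suc b)              ≡⟨ cong suc (sym (thickness[k-1] d₋≡ b₋≡)) ⟩
      suc (thickness (k - 1ℤ))       ∎)
      where open ≡-Reasoning

  moveSnake : ∀ {k s} → Move k s → Snake
  moveSnake {k} (level _) = O
  moveSnake {k} (up _)    = L (thickness (k - 1ℤ))
  moveSnake {k} (down _)  = R (thickness k)

  snakeSeq≡moveSnake : ∀ k → snakeSeq lam μ k ≡ moveSnake (move k)
  snakeSeq≡moveSnake k = trans (snakeSeq≡ k) (bySize (move k))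
    where
    bySize : ∀ {s} (m : Move k s) → snakeOfSize (thickness (k - 1ℤ) ℕ.+ thickness k) s ≡ moveSnake m
    bySize (level e) rewrite e with thickness k
    ... | zero  = refl
    ... | suc t rewrite ℕP.+-suc t t | half-odd t = refl
    bySize (up e) rewrite e | ℕP.+-suc (thickness (k - 1ℤ)) (thickness (k - 1ℤ)) | half-even (thickness (k - 1ℤ)) = refl
    bySize (down e) rewrite e | half-even (thickness k) = refl

  Up Down : ℤ → Set
  Up k   = thickness k ≡ suc (thickness (k - 1ℤ))
  Down k = thickness (k - 1ℤ) ≡ suc (thickness k)

  up? : ∀ k → Dec (Up k)
  up? k = thickness k ℕP.≟ suc (thickness (k - 1ℤ))

  private
    level∧up⇒⊥ : ∀ {k} → thickness (k - 1ℤ) ≡ thickness k → ¬ Up k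
    level∧up⇒⊥ e u = ℕP.1+n≢n (sym (trans e u))

    level∧down⇒⊥ : ∀ {k} → thickness (k - 1ℤ) ≡ thickness k → ¬ Down k
    level∧down⇒⊥ e d = ℕP.1+n≢n (sym (trans (sym e) d))

    up∧down⇒⊥ : ∀ {k} → Up k → ¬ Down k
    up∧down⇒⊥ {k} u d = ℕP.<-asym (subst (thickness (k - 1ℤ) ℕ.<_) (sym u) (ℕP.n<1+n _))
                                   (subst (thickness k ℕ.<_) (sym d) (ℕP.n<1+n _))

  up⇒L : ∀ k → Up k → snakeSeq lam μ k ≡ L (thickness (k - 1ℤ))
  up⇒L k u = trans (snakeSeq≡moveSnake k) (snakeOf (move k))
    where
    snakeOf : ∀ {s} (m : Move k s) → moveSnake m ≡ L (thickness (k - 1ℤ))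
    snakeOf (level e) = ⊥-elim (level∧up⇒⊥ e u)
    snakeOf (up _)    = refl
    snakeOf (down d)  = ⊥-elim (up∧down⇒⊥ u d)

  down⇒R : ∀ k → Down k → snakeSeq lam μ k ≡ R (thickness k)
  down⇒R k d = trans (snakeSeq≡moveSnake k) (snakeOf (move k))
    where
    snakeOf : ∀ {s} (m : Move k s) → moveSnake m ≡ R (thickness k)
    snakeOf (level e) = ⊥-elim (level∧down⇒⊥ e d)
    snakeOf (up u)    = ⊥-elim (up∧down⇒⊥ u d)
    snakeOf (down _)  = refl

  L⇒up : ∀ k t → snakeSeq lam μ k ≡ L t → thickness (k - 1ℤ) ≡ t × thickness k ≡ suc t
  L⇒up k t e = fromMove (move k) (trans (sym (snakeSeq≡moveSnake k)) e)
    where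
    fromMove : ∀ {s} (m : Move k s) → moveSnake m ≡ L t → thickness (k - 1ℤ) ≡ t × thickness k ≡ suc t
    fromMove (level _) ()
    fromMove (up u) refl = refl , u
    fromMove (down _) ()

  R⇒down : ∀ k t → snakeSeq lam μ k ≡ R t → thickness k ≡ t × thickness (k - 1ℤ) ≡ suc t
  R⇒down k t e = fromMove (move k) (trans (sym (snakeSeq≡moveSnake k)) e)
    where
    fromMove : ∀ {s} (m : Move k s) → moveSnake m ≡ R t → thickness k ≡ t × thickness (k - 1ℤ) ≡ suc t
    fromMove (level _) ()
    fromMove (up _) ()
    fromMove (down d) refl = refl , d

  rise≤1 : ∀ k → thickness k ℕ.≤ suc (thickness (k - 1ℤ))
  rise≤1 k = bound (move k)
    where
    bound : ∀ {s} → Move k s → thickness k ℕ.≤ suc (thickness (k - 1ℤ))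
    bound (level e) = ℕP.≤-trans (ℕP.≤-reflexive (sym e)) (ℕP.n≤1+n _)
    bound (up u)    = ℕP.≤-reflexive u
    bound (down d)  = ℕP.≤-trans (ℕP.n≤1+n _) (ℕP.≤-trans (ℕP.≤-reflexive (sym d)) (ℕP.n≤1+n _))

  fall≤1 : ∀ k → thickness (k - 1ℤ) ℕ.≤ suc (thickness k)
  fall≤1 k = bound (move k)
    where
    bound : ∀ {s} → Move k s → thickness (k - 1ℤ) ℕ.≤ suc (thickness k)
    bound (level e) = ℕP.≤-trans (ℕP.≤-reflexive e) (ℕP.n≤1+n _)
    bound (up u)    = ℕP.≤-trans (ℕP.n≤1+n _) (ℕP.≤-trans (ℕP.≤-reflexive (sym u)) (ℕP.n≤1+n _))
    bound (down d)  = ℕP.≤-reflexive d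

module Rank (lam μ : List ℕ) (pλ : IsPartition lam) (pμ : IsPartition μ) (μ⊆λ : μ ⊆ᵖ lam) where

  open Skew lam μ pλ pμ μ⊆λ

  ℓλ λ₁ : ℕ
  ℓλ = length lam
  λ₁ = part lam 1

  -- All moves of the thickness happen at indices -ℓ(λ), …, λ₁ - 1.
  start : ℤ
  start = - (+ ℓλ)

  span : ℕ
  span = ℓλ ℕ.+ λ₁

  window : List ℤ
  window = interval start span

  start+span≡λ₁ : start + + span ≡ + λ₁
  start+span≡λ₁ = trans (cong (λ x → start + x) (ℤP.pos-+ ℓλ λ₁)) (e (+ ℓλ) (+ λ₁))
    where
    e : ∀ a b → - a + (a + b) ≡ b
    e = solve-∀

  thickness-below : ∀ k → k < start → thickness k ≡ 0
  thickness-below k k<start = ℕP.m≤n⇒m∸n≡0 depthλ≤depthμ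
    where
    depthλ≤depthμ : depth lam k ℕ.≤ depth μ k
    depthλ≤depthμ with depth lam k in eq
    ... | zero  = z≤n
    ... | suc t = Dμ.<lastContent⇒≤depth k (suc t) (s≤s z≤n) (ℤP.<-≤-trans k<-r -r≤)
      where
      k<-r : k < - (+ suc t)
      k<-r with suc t ℕ.≤? ℓλ
      ... | yes r≤ℓ = ℤP.<-≤-trans k<start (ℤP.neg-mono-≤ (+≤+ r≤ℓ))
      ... | no  r≰ℓ = subst (k <_) (lastContent-beyond-length lam (suc t) (ℕP.≰⇒> r≰ℓ))
                        (Dλ.≤depth⇒<lastContent k (suc t) (s≤s z≤n) (ℕP.≤-reflexive (sym eq)))
      -r≤ : - (+ suc t) ≤ lastContent μ (suc t)
      -r≤ = subst (_≤ lastContent μ (suc t)) (ℤP.+-identityˡ (- (+ suc t))) (ℤP.+-monoˡ-≤ (- (+ suc t)) (+≤+ {0} {part μ (suc t)} z≤n))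

  thickness-above : ∀ k → + λ₁ - 1ℤ ≤ k → thickness k ≡ 0
  thickness-above k λ₁-1≤k with depth lam k in eq
  ... | zero  = ℕP.0∸n≡0 (depth μ k)
  ... | suc t = ⊥-elim (ℤP.<-irrefl refl (ℤP.<-≤-trans (ℤP.<-≤-trans k< lastContent≤) λ₁-1≤k))
    where
    k< : k < lastContent lam (suc t)
    k< = Dλ.≤depth⇒<lastContent k (suc t) (s≤s z≤n) (ℕP.≤-reflexive (sym eq))
    e : ∀ p t → p - (1ℤ + t) ≡ p - 1ℤ - t
    e = solve-∀
    lastContent≤ : lastContent lam (suc t) ≤ + λ₁ - 1ℤ
    lastContent≤ = ℤP.≤-trans (ℤP.≤-reflexive (e (+ part lam (suc t)) (+ t)))
      (ℤP.≤-trans (ℤP.i-j≤i (+ part lam (suc t) - 1ℤ) (+ t)) (ℤP.+-monoˡ-≤ (- 1ℤ) (+≤+ (part≤part₁ pλ (suc t)))))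

  thickness-flat-outside : ∀ k → k < start ⊎ start + + span ≤ k → thickness k ≡ thickness (k - 1ℤ)
  thickness-flat-outside k (inj₁ k<start) =
    trans (thickness-below k k<start) (sym (thickness-below (k - 1ℤ) (ℤP.<-trans (i-1<i k) k<start)))
  thickness-flat-outside k (inj₂ end≤k) =
    trans (thickness-above k (ℤP.≤-trans (ℤP.<⇒≤ (i-1<i (+ λ₁))) λ₁≤k)) (sym (thickness-above (k - 1ℤ) (ℤP.+-monoˡ-≤ (- 1ℤ) λ₁≤k)))
    where
    λ₁≤k : + λ₁ ≤ k
    λ₁≤k = subst (_≤ k) start+span≡λ₁ end≤k

  thickness-start : thickness (start - 1ℤ) ≡ 0
  thickness-start = thickness-below (start - 1ℤ) (i-1<i start)

  thickness-end : thickness (start + + span - 1ℤ) ≡ 0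
  thickness-end = thickness-above _ (ℤP.≤-reflexive (cong (_- 1ℤ) (sym start+span≡λ₁)))

  depthλ≤ℓλ+i : ∀ K i → - (+ i) ≤ K → depth lam K ℕ.≤ ℓλ ℕ.+ i
  depthλ≤ℓλ+i K i -i≤K with depth lam K in eq
  ... | zero  = z≤n
  ... | suc t with suc t ℕ.≤? ℓλ
  ...   | yes r≤ℓ = ℕP.≤-trans r≤ℓ (ℕP.m≤m+n ℓλ i)
  ...   | no  r≰ℓ = ℕP.≤-trans (ℕP.<⇒≤ r<i) (ℕP.m≤n+m i ℓλ)
    where
    K<-r : K < - (+ suc t)
    K<-r = subst (K <_) (lastContent-beyond-length lam (suc t) (ℕP.≰⇒> r≰ℓ))
             (Dλ.≤depth⇒<lastContent K (suc t) (s≤s z≤n) (ℕP.≤-reflexive (sym eq)))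
    r<i : suc t ℕ.< i
    r<i = ℤP.drop‿+<+ (subst₂ _<_ (ℤP.neg-involutive (+ suc t)) (ℤP.neg-involutive (+ i))
            (ℤP.neg-mono-< (ℤP.≤-<-trans -i≤K K<-r)))

  -- Square (i, j) has content j - i, so it is counted by thickness (diagonalOf i j).
  diagonalOf : ℕ → ℕ → ℤ
  diagonalOf i j = + j - + i - 1ℤ

  -- Outside and inside corners are read off the boundary path of μ around the diagonal K
  -- of the corner: μ turns from a vertical step at K to a horizontal one at K + 1 at an
  -- outside corner, and the other way round at an inside corner.
  OutsideTurn InsideTurn : ℤ → Set
  OutsideTurn K = depth μ (K - 1ℤ) ≡ suc (depth μ K) × depth μ K ≡ depth μ (K + 1ℤ)
  InsideTurn  K = depth μ (K - 1ℤ) ≡ depth μ K × depth μ K ≡ suc (depth μ (K + 1ℤ))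

  outsideTurn? : ∀ K → Dec (OutsideTurn K)
  outsideTurn? K = (depth μ (K - 1ℤ) ℕP.≟ suc (depth μ K)) ×-dec (depth μ K ℕP.≟ depth μ (K + 1ℤ))
  insideTurn? : ∀ K → Dec (InsideTurn K)
  insideTurn? K = (depth μ (K - 1ℤ) ℕP.≟ depth μ K) ×-dec (depth μ K ℕP.≟ suc (depth μ (K + 1ℤ)))

  outsideTerm insideTerm : ℤ → ℕ
  outsideTerm K = thickness K ℕ.* [ outsideTurn? K ]
  insideTerm  K = thickness K ℕ.* [ insideTurn? K ]

  module Corner (i′ j : ℕ) (1≤j : 1 ℕ.≤ j) where

    i : ℕ
    i = suc i′

    K : ℤ
    K = diagonalOf i j

    a a₋ a₊ b b₋ b₊ : ℕ
    a  = depth lam K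
    a₋ = depth lam (K - 1ℤ)
    a₊ = depth lam (K + 1ℤ)
    b  = depth μ K
    b₋ = depth μ (K - 1ℤ)
    b₊ = depth μ (K + 1ℤ)

    private
      up-row : + i - 1ℤ ≡ + i′
      up-row = e (+ i′)
        where
        e : ∀ z → 1ℤ + z - 1ℤ ≡ z
        e = solve-∀
      up-diag : K + 1ℤ ≡ + j - (+ i - 1ℤ) - 1ℤ
      up-diag = e (+ j) (+ i)
        where
        e : ∀ y x → y - x - 1ℤ + 1ℤ ≡ y - (x - 1ℤ) - 1ℤ
        e = solve-∀
      left-diag : K - 1ℤ ≡ (+ j - 1ℤ) - + i - 1ℤ
      left-diag = e (+ j) (+ i)
        where
        e : ∀ y x → y - x - 1ℤ - 1ℤ ≡ (y - 1ℤ) - x - 1ℤ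
        e = solve-∀
      up-left-diag : K ≡ (+ j - 1ℤ) - (+ i - 1ℤ) - 1ℤ
      up-left-diag = e (+ j) (+ i)
        where
        e : ∀ y x → y - x - 1ℤ ≡ (y - 1ℤ) - (x - 1ℤ) - 1ℤ
        e = solve-∀
      shift : ∀ α → depth α (K + 1ℤ - 1ℤ) ≡ depth α K
      shift α = cong (depth α) (i+1-1≡i K)

      a≤a₋ : a ℕ.≤ a₋
      a≤a₋ = Dλ.depth≤depth[k-1] K
      a≤1+a₊ : a ℕ.≤ suc a₊
      a≤1+a₊ = subst (ℕ._≤ suc a₊) (shift lam) (Dλ.depth[k-1]≤1+depth (K + 1ℤ))
      b₊≤b : b₊ ℕ.≤ b
      b₊≤b = subst (b₊ ℕ.≤_) (shift μ) (Dμ.depth≤depth[k-1] (K + 1ℤ))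
      b≤1+b₊ : b ℕ.≤ suc b₊
      b≤1+b₊ = subst (ℕ._≤ suc b₊) (shift μ) (Dμ.depth[k-1]≤1+depth (K + 1ℤ))
      b≤b₋ : b ℕ.≤ b₋
      b≤b₋ = Dμ.depth≤depth[k-1] K
      b₋≤1+b : b₋ ℕ.≤ suc b
      b₋≤1+b = Dμ.depth[k-1]≤1+depth K

    -- (i, j) ∈ λ/μ means depth μ K < i ≤ depth λ K; it is a top corner when i is the
    -- topmost square of λ/μ on its diagonal, i.e. i = depth μ K + 1.
    outside⇒ : OutsideCorner lam μ (+ i) (+ j) → i ≡ suc b × i ℕ.≤ a × OutsideTurn K
    outside⇒ (in00 , ¬in10 , ¬in01) = cong suc (sym b≡i′) , i≤a , b₋≡ , trans b≡i′ (sym b₊≡i′)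
      where
      b<i : b ℕ.< i
      b<i = proj₁ (inSkew⇒ refl refl in00)
      i≤a : i ℕ.≤ a
      i≤a = proj₂ (inSkew⇒ refl refl in00)
      i′≤b₊ : i′ ℕ.≤ b₊
      i′≤b₊ = ℕP.≮⇒≥ (λ lt → ¬in10 (inSkew⇐ up-row up-diag lt (ℕP.≤-pred (ℕP.≤-trans i≤a a≤1+a₊))))
      i≤b₋ : i ℕ.≤ b₋
      i≤b₋ = ℕP.≮⇒≥ (λ lt → ¬in01 (inSkew⇐ refl left-diag lt (ℕP.≤-trans i≤a a≤a₋)))
      b≡i′ : b ≡ i′
      b≡i′ = ℕP.≤-antisym (ℕP.≤-pred b<i) (ℕP.≤-trans i′≤b₊ b₊≤b)
      b₊≡i′ : b₊ ≡ i′
      b₊≡i′ = ℕP.≤-antisym (subst (b₊ ℕ.≤_) b≡i′ b₊≤b) i′≤b₊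
      b₋≡ : b₋ ≡ suc b
      b₋≡ = ℕP.≤-antisym b₋≤1+b (subst (λ z → suc z ℕ.≤ b₋) (sym b≡i′) i≤b₋)

    outside⇐ : i ≡ suc b → i ℕ.≤ a → OutsideTurn K → OutsideCorner lam μ (+ i) (+ j)
    outside⇐ i≡ i≤a (b₋≡ , b≡b₊) = inSkew⇐ refl refl (subst (b ℕ.<_) (sym i≡) ℕP.≤-refl) i≤a , ¬in10 , ¬in01
      where
      ¬in10 : ¬ InSkew lam μ (+ i - 1ℤ) (+ j)
      ¬in10 s = ℕP.<-irrefl (trans (sym b≡b₊) (sym (ℕP.suc-injective i≡))) (proj₁ (inSkew⇒ up-row up-diag s))
      ¬in01 : ¬ InSkew lam μ (+ i) (+ j - 1ℤ)
      ¬in01 s = ℕP.<-irrefl (trans b₋≡ (sym i≡)) (proj₁ (inSkew⇒ refl left-diag s))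

    inside⇒ : InsideCorner lam μ (+ i) (+ j) → i ≡ suc b × i ℕ.≤ a × InsideTurn K
    inside⇒ (in00 , in10 , in01 , ¬in11) = cong suc (sym b≡i′) , i≤a , b₋≡ , b≡
      where
      b<i : b ℕ.< i
      b<i = proj₁ (inSkew⇒ refl refl in00)
      i≤a : i ℕ.≤ a
      i≤a = proj₂ (inSkew⇒ refl refl in00)
      b₊<i′ : b₊ ℕ.< i′
      b₊<i′ = proj₁ (inSkew⇒ up-row up-diag in10)
      b₋<i : b₋ ℕ.< i
      b₋<i = proj₁ (inSkew⇒ refl left-diag in01)
      i′≤b : i′ ℕ.≤ b
      i′≤b = ℕP.≮⇒≥ (λ lt → ¬in11 (inSkew⇐ up-row up-left-diag lt (ℕP.≤-trans (ℕP.n≤1+n i′) i≤a)))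
      b≡i′ : b ≡ i′
      b≡i′ = ℕP.≤-antisym (ℕP.≤-pred b<i) i′≤b
      b≡ : b ≡ suc b₊
      b≡ = ℕP.≤-antisym b≤1+b₊ (subst (suc b₊ ℕ.≤_) (sym b≡i′) b₊<i′)
      b₋≡ : b₋ ≡ b
      b₋≡ = ℕP.≤-antisym (ℕP.≤-pred (subst (b₋ ℕ.<_) (cong suc (sym b≡i′)) b₋<i)) b≤b₋

    inside⇐ : i ≡ suc b → i ℕ.≤ a → InsideTurn K → InsideCorner lam μ (+ i) (+ j)
    inside⇐ i≡ i≤a (b₋≡ , b≡) =
        inSkew⇐ refl refl (subst (b ℕ.<_) (sym i≡) ℕP.≤-refl) i≤a
      , inSkew⇐ up-row up-diag (subst (b₊ ℕ.<_) (trans (sym b≡) (ℕP.suc-injective (sym i≡))) ℕP.≤-refl)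
                (ℕP.≤-pred (ℕP.≤-trans i≤a a≤1+a₊))
      , inSkew⇐ refl left-diag (subst (b₋ ℕ.<_) (sym i≡) (subst (ℕ._< suc b) (sym b₋≡) ℕP.≤-refl)) (ℕP.≤-trans i≤a a≤a₋)
      , λ s → ℕP.<-irrefl (ℕP.suc-injective (sym i≡)) (proj₁ (inSkew⇒ up-row up-left-diag s))

    diagLen≡ : i ≡ suc b → i ℕ.≤ a → diagLen lam μ (+ i) (+ j) ≡ a ℕ.∸ b
    diagLen≡ i≡ i≤a = sum-upTo-indicator (suc ℓλ) (a ℕ.∸ b) _ bound onDiagonal
      where
      bound : a ℕ.∸ b ℕ.≤ suc ℓλ
      bound = ℕP.m≤n+o⇒m∸n≤o a b (subst (a ℕ.≤_) (trans (cong (ℓλ ℕ.+_) i≡) (swap-suc ℓλ b))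
                (depthλ≤ℓλ+i K i (-i≤K j 1≤j)))
        where
        swap-suc : ∀ m n → m ℕ.+ suc n ≡ n ℕ.+ suc m
        swap-suc m n = trans (ℕP.+-suc m n) (trans (cong suc (ℕP.+-comm m n)) (sym (ℕP.+-suc n m)))
        -i≤K : ∀ j → 1 ℕ.≤ j → - (+ i) ≤ diagonalOf i j
        -i≤K (suc j′) _ = subst (- (+ i) ≤_) (e (+ i) (+ j′)) (ℤP.i≤i+j (- (+ i)) (+ j′))
          where
          e : ∀ i j → - i + j ≡ 1ℤ + j - i - 1ℤ
          e = solve-∀
      diag-p : ∀ p → K ≡ (+ j + + p) - (+ i + + p) - 1ℤ
      diag-p p = e (+ j) (+ i) (+ p)
        where
        e : ∀ y x p → y - x - 1ℤ ≡ (y + p) - (x + p) - 1ℤ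
        e = solve-∀
      onDiagonal : ∀ p → p ℕ.< suc ℓλ → [ inSkew? lam μ (+ i + + p) (+ j + + p) ] ≡ [ p ℕ.<? a ℕ.∸ b ]
      onDiagonal p _ = [ inSkew? lam μ (+ i + + p) (+ j + + p) ]-cong (p ℕ.<? a ℕ.∸ b) to from
        where
        i+p≡ : i ℕ.+ p ≡ suc (b ℕ.+ p)
        i+p≡ = cong (ℕ._+ p) i≡
        to : InSkew lam μ (+ i + + p) (+ j + + p) → p ℕ.< a ℕ.∸ b
        to s = +<⇒<∸ (subst (ℕ._≤ a) (trans i+p≡ (cong suc (ℕP.+-comm b p)))
                 (proj₂ (inSkew⇒ (sym (ℤP.pos-+ i p)) (diag-p p) s)))
        from : p ℕ.< a ℕ.∸ b → InSkew lam μ (+ i + + p) (+ j + + p)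
        from p< = inSkew⇐ (sym (ℤP.pos-+ i p)) (diag-p p) (subst (b ℕ.<_) (sym i+p≡) (s≤s (ℕP.m≤m+n b p)))
                    (subst (ℕ._≤ a) (trans (cong suc (ℕP.+-comm p b)) (sym i+p≡)) (<∸⇒+< p<))

    private
      cornerTerm : ∀ {C T : Set} (c? : Dec C) (t? : Dec T) →
        (C → i ≡ suc b × i ℕ.≤ a × T) → (i ≡ suc b → i ℕ.≤ a → T → C) →
        [ c? ] ℕ.* diagLen lam μ (+ i) (+ j) ≡ [ i ℕP.≟ suc b ] ℕ.* (thickness K ℕ.* [ t? ])
      cornerTerm (yes c) t? c⇒ _ with c⇒ c
      ... | i≡ , i≤a , t rewrite [ i ℕP.≟ suc b ]-yes i≡ | [ t? ]-yes t =
        trans (ℕP.+-identityʳ _) (trans (diagLen≡ i≡ i≤a) (sym (trans (ℕP.+-identityʳ _) (ℕP.*-identityʳ _))))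
      cornerTerm (no ¬c) t? _ ⇒c with i ℕP.≟ suc b | t?
      ... | no _   | _     = refl
      ... | yes _  | no _  = sym (trans (ℕP.+-identityʳ _) (ℕP.*-zeroʳ (thickness K)))
      ... | yes i≡ | yes t with b ℕ.<? a
      ...   | yes b<a = ⊥-elim (¬c (⇒c i≡ (subst (ℕ._≤ a) (sym i≡) b<a) t))
      ...   | no  b≮a rewrite ℕP.m≤n⇒m∸n≡0 (ℕP.≮⇒≥ b≮a) = refl

    outsideTerm≡ : [ outsideCorner? lam μ (+ i) (+ j) ] ℕ.* diagLen lam μ (+ i) (+ j) ≡ [ i ℕP.≟ suc b ] ℕ.* outsideTerm K
    outsideTerm≡ = cornerTerm (outsideCorner? lam μ (+ i) (+ j)) (outsideTurn? K) outside⇒ outside⇐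

    insideTerm≡ : [ insideCorner? lam μ (+ i) (+ j) ] ℕ.* diagLen lam μ (+ i) (+ j) ≡ [ i ℕP.≟ suc b ] ℕ.* insideTerm K
    insideTerm≡ = cornerTerm (insideCorner? lam μ (+ i) (+ j)) (insideTurn? K) inside⇒ inside⇐

  topSquare : ∀ K → thickness K ≢ 0 →
    suc (depth μ K) ℕ.≤ ℓλ × ∃[ j ] (1 ℕ.≤ j × j ℕ.≤ λ₁ × diagonalOf (suc (depth μ K)) j ≡ K)
  topSquare K K-thick = i≤ℓλ , ∣ y ∣ , 1≤j , j≤λ₁ , diagonal≡
    where
    i : ℕ
    i = suc (depth μ K)
    y : ℤ
    y = K + + i + 1ℤ
    K≡ : K ≡ y - + i - 1ℤ
    K≡ = e K (+ i)
      where
      e : ∀ k i → k ≡ k + i + 1ℤ - i - 1ℤ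
      e = solve-∀
    square : InSkew lam μ (+ i) y
    square = inSkew⇐ refl K≡ ℕP.≤-refl (ℕP.m∸n≢0⇒n<m K-thick)
    1≤y : 1ℤ ≤ y
    1≤y = i<j⇒i+1≤j (ℤP.≤-<-trans (+≤+ z≤n) (proj₁ (proj₂ square)))
    y≡ : + ∣ y ∣ ≡ y
    y≡ = ℤP.0≤i⇒+∣i∣≡i (ℤP.≤-trans (+≤+ z≤n) 1≤y)
    1≤j : 1 ℕ.≤ ∣ y ∣
    1≤j = ℤP.drop‿+≤+ (subst (1ℤ ≤_) (sym y≡) 1≤y)
    j≤part : ∣ y ∣ ℕ.≤ part lam i
    j≤part = ℤP.drop‿+≤+ (subst (_≤ + part lam i) (sym y≡) (proj₂ (proj₂ square)))
    j≤λ₁ : ∣ y ∣ ℕ.≤ λ₁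
    j≤λ₁ = ℕP.≤-trans j≤part (part≤part₁ pλ i)
    i≤ℓλ : i ℕ.≤ ℓλ
    i≤ℓλ = part-positive⇒≤length lam i (ℕP.<-≤-trans 1≤j j≤part)
    diagonal≡ : diagonalOf i ∣ y ∣ ≡ K
    diagonal≡ = trans (cong (λ z → z - + i - 1ℤ) y≡) (sym K≡)

  diagonalOf∈window : ∀ i j → 1 ℕ.≤ i → i ℕ.≤ ℓλ → 1 ℕ.≤ j → j ℕ.≤ λ₁ → diagonalOf i j ∈ window
  diagonalOf∈window i (suc j′) 1≤i i≤ℓλ _ j≤λ₁ = ∈-interval⁺ start≤ <end
    where
    d : ℕ
    d = ℓλ ℕ.∸ i
    ℓλ≡ : + ℓλ ≡ + i + + d
    ℓλ≡ = trans (cong +_ (sym (ℕP.m+[n∸m]≡n i≤ℓλ))) (ℤP.pos-+ i d)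
    start≤ : start ≤ diagonalOf i (suc j′)
    start≤ = subst₂ _≤_ (cong -_ (sym ℓλ≡)) eq (ℤP.i≤i+j (- (+ i + + d)) (+ (j′ ℕ.+ d)))
      where
      e : ∀ i d j → - (i + d) + (j + d) ≡ 1ℤ + j - i - 1ℤ
      e = solve-∀
      eq : - (+ i + + d) + + (j′ ℕ.+ d) ≡ diagonalOf i (suc j′)
      eq = trans (cong (λ z → - (+ i + + d) + z) (ℤP.pos-+ j′ d)) (e (+ i) (+ d) (+ j′))
    <end : diagonalOf i (suc j′) < start + + span
    <end = subst (diagonalOf i (suc j′) <_) (sym start+span≡λ₁) (ℤP.<-≤-trans K<j (+≤+ j≤λ₁))
      where
      e : ∀ j i → j - i - 1ℤ + 1ℤ + i ≡ j
      e = solve-∀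
      K<j : diagonalOf i (suc j′) < + suc j′
      K<j = i+1≤j⇒i<j (subst (diagonalOf i (suc j′) + 1ℤ ≤_) (e (+ suc j′) (+ i))
              (ℤP.i≤i+j (diagonalOf i (suc j′) + 1ℤ) (+ i)))

  diagonalOf-injective : ∀ i {j j′} → diagonalOf i j ≡ diagonalOf i j′ → j ≡ j′
  diagonalOf-injective i {j} {j′} e =
    ℤP.+-injective (trans (sym (e′ (+ j) (+ i))) (trans (cong (λ z → z + 1ℤ + + i) e) (e′ (+ j′) (+ i))))
    where
    e′ : ∀ j i → j - i - 1ℤ + 1ℤ + i ≡ j
    e′ = solve-∀

  rows cols : List ℕ
  rows = range ℓλ
  cols = range λ₁

  -- Each diagonal K of positive thickness has exactly one top square (depth μ K + 1, j)
  -- among the cells, so a sum over cells of terms supported on top squares is a sum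
  -- over diagonals.
  sum-topSquares : (F : ℤ → ℕ) → (∀ K → F K ≢ 0 → thickness K ≢ 0) →
    sum (map (λ i → sum (map (λ j → [ i ℕP.≟ suc (depth μ (diagonalOf i j)) ] ℕ.* F (diagonalOf i j)) cols)) rows)
    ≡ sum (map F window)
  sum-topSquares F F⇒thick = begin
      sum (map (λ i → sum (map (λ j → H i (diagonalOf i j)) cols)) rows)
    ≡⟨ sum-map-cong rows (λ i i∈ → sum-map-cong cols (λ j j∈ → sym (sum-select ℤ._≟_ window (diagonalOf i j) (H i)
         (interval-unique start span)
         (diagonalOf∈window i j (proj₁ (∈-range⁻ i∈)) (proj₂ (∈-range⁻ i∈)) (proj₁ (∈-range⁻ j∈)) (proj₂ (∈-range⁻ j∈)))))) ⟩
      sum (map (λ i → sum (map (λ j → sum (map (λ K → [ K ℤ.≟ diagonalOf i j ] ℕ.* H i K) window)) cols)) rows)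
    ≡⟨ sum-map-cong rows (λ i _ → sum-map-swap cols window (λ j K → [ K ℤ.≟ diagonalOf i j ] ℕ.* H i K)) ⟩
      sum (map (λ i → sum (map (λ K → sum (map (λ j → [ K ℤ.≟ diagonalOf i j ] ℕ.* H i K) cols)) window)) rows)
    ≡⟨ sum-map-swap rows window (λ i K → sum (map (λ j → [ K ℤ.≟ diagonalOf i j ] ℕ.* H i K) cols)) ⟩
      sum (map (λ K → sum (map (λ i → sum (map (λ j → [ K ℤ.≟ diagonalOf i j ] ℕ.* H i K) cols)) rows)) window)
    ≡⟨ sum-map-cong window (λ K _ → onDiagonal K) ⟩
      sum (map F window)
    ∎
    where
    open ≡-Reasoning
    H : ℕ → ℤ → ℕ
    H i K = [ i ℕP.≟ suc (depth μ K) ] ℕ.* F K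
    #cols : ℤ → ℕ → ℕ
    #cols K i = sum (map (λ j → [ K ℤ.≟ diagonalOf i j ]) cols)
    onDiagonal : ∀ K → sum (map (λ i → sum (map (λ j → [ K ℤ.≟ diagonalOf i j ] ℕ.* H i K) cols)) rows) ≡ F K
    onDiagonal K with F K ℕP.≟ 0
    ... | yes F≡0 = trans (sum-map-zero rows _ (λ i _ → sum-map-zero cols _ (λ j _ →
                      trans (cong (λ w → [ K ℤ.≟ diagonalOf i j ] ℕ.* ([ i ℕP.≟ suc (depth μ K) ] ℕ.* w)) F≡0)
                            (trans (cong ([ K ℤ.≟ diagonalOf i j ] ℕ.*_) (ℕP.*-zeroʳ [ i ℕP.≟ suc (depth μ K) ])) (ℕP.*-zeroʳ [ K ℤ.≟ diagonalOf i j ]))))) (sym F≡0)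
    ... | no F≢0 with topSquare K (F⇒thick K F≢0)
    ...   | i₀≤ℓλ , j₀ , 1≤j₀ , j₀≤λ₁ , diagonal≡ = begin
        sum (map (λ i → sum (map (λ j → [ K ℤ.≟ diagonalOf i j ] ℕ.* H i K) cols)) rows)
      ≡⟨ sum-map-cong rows (λ i _ → factor i) ⟩
        sum (map (λ i → [ i ℕP.≟ i₀ ] ℕ.* (F K ℕ.* #cols K i)) rows)
      ≡⟨ sum-select ℕP._≟_ rows i₀ (λ i → F K ℕ.* #cols K i) (range-unique ℓλ) (∈-range⁺ (s≤s z≤n) i₀≤ℓλ) ⟩
        F K ℕ.* #cols K i₀
      ≡⟨ cong (F K ℕ.*_) one-column ⟩
        F K ℕ.* 1
      ≡⟨ ℕP.*-identityʳ (F K) ⟩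
        F K
      ∎
      where
      i₀ : ℕ
      i₀ = suc (depth μ K)
      factor : ∀ i → sum (map (λ j → [ K ℤ.≟ diagonalOf i j ] ℕ.* H i K) cols) ≡ [ i ℕP.≟ i₀ ] ℕ.* (F K ℕ.* #cols K i)
      factor i = trans (sum-map-cong cols (λ j _ → ℕP.*-comm [ K ℤ.≟ diagonalOf i j ] (H i K)))
                   (trans (sum-map-*ˡ cols (H i K) (λ j → [ K ℤ.≟ diagonalOf i j ])) (ℕP.*-assoc [ i ℕP.≟ i₀ ] (F K) (#cols K i)))
      one-column : #cols K i₀ ≡ 1
      one-column = trans (sum-map-cong cols (λ j _ → trans ([ K ℤ.≟ diagonalOf i₀ j ]-cong (j ℕP.≟ j₀) on off) (sym (ℕP.*-identityʳ _))))
                         (sum-select ℕP._≟_ cols j₀ (λ _ → 1) (range-unique λ₁) (∈-range⁺ 1≤j₀ j₀≤λ₁))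
        where
        on : ∀ {j} → K ≡ diagonalOf i₀ j → j ≡ j₀
        on e = diagonalOf-injective i₀ (trans (sym e) (sym diagonal≡))
        off : ∀ {j} → j ≡ j₀ → K ≡ diagonalOf i₀ j
        off refl = sym diagonal≡

  cornerSum : {C : ℤ → ℤ → Set} → (∀ x y → Dec (C x y)) → ℕ
  cornerSum corner? = sum (map (λ c → [ corner? (proj₁ c) (proj₂ c) ] ℕ.* diagLen lam μ (proj₁ c) (proj₂ c)) (cells lam))

  cornerSum≡ : {C : ℤ → ℤ → Set} (corner? : ∀ x y → Dec (C x y)) (term : ℤ → ℕ) →
    (∀ K → term K ≢ 0 → thickness K ≢ 0) →
    (∀ i′ j → 1 ℕ.≤ j → [ corner? (+ suc i′) (+ j) ] ℕ.* diagLen lam μ (+ suc i′) (+ j)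
                        ≡ [ suc i′ ℕP.≟ suc (depth μ (diagonalOf (suc i′) j)) ] ℕ.* term (diagonalOf (suc i′) j)) →
    cornerSum corner? ≡ sum (map term window)
  cornerSum≡ corner? term term⇒thick onCell = begin
      cornerSum corner?
    ≡⟨ sum-map-concatMap rows (λ i → map (λ j → (+ i , + j)) cols) f ⟩
      sum (map (λ i → sum (map f (map (λ j → (+ i , + j)) cols))) rows)
    ≡⟨ sum-map-cong rows (λ i i∈ → trans (cong sum (sym (LP.map-∘ cols)))
                      (sum-map-cong cols (λ j j∈ → onCell′ i j (proj₁ (∈-range⁻ i∈)) (proj₁ (∈-range⁻ j∈))))) ⟩
      sum (map (λ i → sum (map (λ j → [ i ℕP.≟ suc (depth μ (diagonalOf i j)) ] ℕ.* term (diagonalOf i j)) cols)) rows)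
    ≡⟨ sum-topSquares term term⇒thick ⟩
      sum (map term window)
    ∎
    where
    open ≡-Reasoning
    f : ℤ × ℤ → ℕ
    f c = [ corner? (proj₁ c) (proj₂ c) ] ℕ.* diagLen lam μ (proj₁ c) (proj₂ c)
    onCell′ : ∀ i j → 1 ℕ.≤ i → 1 ℕ.≤ j → f (+ i , + j) ≡ [ i ℕP.≟ suc (depth μ (diagonalOf i j)) ] ℕ.* term (diagonalOf i j)
    onCell′ (suc i′) j _ 1≤j = onCell i′ j 1≤j

  outsideSum≡ : cornerSum (outsideCorner? lam μ) ≡ sum (map outsideTerm window)
  outsideSum≡ = cornerSum≡ (outsideCorner? lam μ) outsideTerm (λ K ≢0 ≡0 → ≢0 (cong (ℕ._* [ outsideTurn? K ]) ≡0))
    (λ i′ j 1≤j → Corner.outsideTerm≡ i′ j 1≤j)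

  insideSum≡ : cornerSum (insideCorner? lam μ) ≡ sum (map insideTerm window)
  insideSum≡ = cornerSum≡ (insideCorner? lam μ) insideTerm (λ K ≢0 ≡0 → ≢0 (cong (ℕ._* [ insideTurn? K ]) ≡0))
    (λ i′ j 1≤j → Corner.insideTerm≡ i′ j 1≤j)

  -- The boundary path of μ has a vertical step at K exactly when its depth drops there.
  verticalμ? : ∀ K → Dec (depth μ (K - 1ℤ) ≡ suc (depth μ K))
  verticalμ? K = depth μ (K - 1ℤ) ℕP.≟ suc (depth μ K)

  horizontalμ? : ∀ K → Dec (depth μ (K - 1ℤ) ≡ depth μ K)
  horizontalμ? K = depth μ (K - 1ℤ) ℕP.≟ depth μ K

  noRise-at-horizontalμ : ∀ K → depth μ (K - 1ℤ) ≡ depth μ K → [ up? K ] ≡ 0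
  noRise-at-horizontalμ K b₋≡b = [ up? K ]-no λ u → ℕP.<-irrefl refl (ℕP.<-≤-trans (subst (thickness (K - 1ℤ) ℕ.<_) (sym u) ℕP.≤-refl)
    (subst (λ b₋ → thickness K ℕ.≤ depth lam (K - 1ℤ) ℕ.∸ b₋) (sym b₋≡b) (ℕP.∸-monoˡ-≤ (depth μ K) (Dλ.depth≤depth[k-1] K))))

  rise-at-verticalμ : ∀ K → depth μ (K - 1ℤ) ≡ suc (depth μ K) → [ up? K ] ℕ.+ thickness (K - 1ℤ) ≡ thickness K
  rise-at-verticalμ K b₋≡ with Dλ.depth-step K
  ... | inj₁ a₋≡a = trans (cong (ℕ._+ thickness (K - 1ℤ)) ([ up? K ]-yes rises)) (sym rises)
    where
    rises : Up K
    rises = begin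
      thickness K                                       ≡⟨ m∸n≡1+m∸1+n (subst₂ ℕ._≤_ b₋≡ a₋≡a (depthμ≤depthλ (K - 1ℤ))) ⟩
      suc (depth lam K ℕ.∸ suc (depth μ K))             ≡⟨ cong₂ (λ a b → suc (a ℕ.∸ b)) (sym a₋≡a) (sym b₋≡) ⟩
      suc (thickness (K - 1ℤ))                          ∎
      where open ≡-Reasoning
  ... | inj₂ a₋≡1+a = trans (cong (ℕ._+ thickness (K - 1ℤ)) ([ up? K ]-no λ u → ℕP.1+n≢n (sym (trans flat u)))) flat
    where
    flat : thickness (K - 1ℤ) ≡ thickness K
    flat = cong₂ ℕ._∸_ a₋≡1+a b₋≡

  stepBits : ∀ K → ([ verticalμ? K ] ≡ 0 × [ horizontalμ? K ] ≡ 1 × [ up? K ] ≡ 0)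
                  ⊎ ([ verticalμ? K ] ≡ 1 × [ horizontalμ? K ] ≡ 0 × [ up? K ] ℕ.+ thickness (K - 1ℤ) ≡ thickness K)
  stepBits K with Dμ.depth-step K
  ... | inj₁ b₋≡b   = inj₁ ( [ verticalμ? K ]-no (λ e → ℕP.1+n≢n (sym (trans (sym b₋≡b) e)))
                           , [ horizontalμ? K ]-yes b₋≡b , noRise-at-horizontalμ K b₋≡b)
  ... | inj₂ b₋≡1+b = inj₂ ( [ verticalμ? K ]-yes b₋≡1+b
                           , [ horizontalμ? K ]-no (λ e → ℕP.1+n≢n (trans (sym b₋≡1+b) e)) , rise-at-verticalμ K b₋≡1+b)

  nextStepBits : ∀ K → ([ depth μ K ℕP.≟ suc (depth μ (K + 1ℤ)) ] ≡ 0 × [ depth μ K ℕP.≟ depth μ (K + 1ℤ) ] ≡ 1)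
                     ⊎ ([ depth μ K ℕP.≟ suc (depth μ (K + 1ℤ)) ] ≡ 1 × [ depth μ K ℕP.≟ depth μ (K + 1ℤ) ] ≡ 0)
  nextStepBits K with Dμ.depth-step (K + 1ℤ)
  ... | inj₁ b≡b₊   = inj₁ ( [ _ ℕP.≟ _ ]-no (λ e → ℕP.1+n≢n (sym (trans (sym (trans (cong (depth μ) (sym (i+1-1≡i K))) b≡b₊)) e)))
                           , [ _ ℕP.≟ _ ]-yes (trans (cong (depth μ) (sym (i+1-1≡i K))) b≡b₊))
  ... | inj₂ b≡1+b₊ = inj₂ ( [ _ ℕP.≟ _ ]-yes (trans (cong (depth μ) (sym (i+1-1≡i K))) b≡1+b₊)
                           , [ _ ℕP.≟ _ ]-no (λ e → ℕP.1+n≢n (trans (sym (trans (cong (depth μ) (sym (i+1-1≡i K))) b≡1+b₊)) e)))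

  balance-bits : ∀ x x₋ u v h v₊ h₊ →
    (v ≡ 0 × h ≡ 1 × u ≡ 0) ⊎ (v ≡ 1 × h ≡ 0 × u ℕ.+ x₋ ≡ x) → (v₊ ≡ 0 × h₊ ≡ 1) ⊎ (v₊ ≡ 1 × h₊ ≡ 0) →
    x ℕ.* (v ℕ.* h₊) ℕ.+ v₊ ℕ.* x ≡ x ℕ.* (h ℕ.* v₊) ℕ.+ u ℕ.+ v ℕ.* x₋
  balance-bits x x₋ _ _ _ v₊ h₊ (inj₁ (refl , refl , refl)) _ = e x x₋ v₊ h₊
    where
    e : ∀ x x₋ v₊ h₊ → x ℕ.* (0 ℕ.* h₊) ℕ.+ v₊ ℕ.* x ≡ x ℕ.* (1 ℕ.* v₊) ℕ.+ 0 ℕ.+ 0 ℕ.* x₋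
    e = ℕ-solve-∀
  balance-bits _ x₋ u _ _ _ _ (inj₂ (refl , refl , refl)) (inj₁ (refl , refl)) = e u x₋
    where
    e : ∀ u x₋ → (u ℕ.+ x₋) ℕ.* (1 ℕ.* 1) ℕ.+ 0 ℕ.* (u ℕ.+ x₋) ≡ (u ℕ.+ x₋) ℕ.* (0 ℕ.* 0) ℕ.+ u ℕ.+ 1 ℕ.* x₋
    e = ℕ-solve-∀
  balance-bits _ x₋ u _ _ _ _ (inj₂ (refl , refl , refl)) (inj₂ (refl , refl)) = e u x₋
    where
    e : ∀ u x₋ → (u ℕ.+ x₋) ℕ.* (1 ℕ.* 0) ℕ.+ 1 ℕ.* (u ℕ.+ x₋) ≡ (u ℕ.+ x₋) ℕ.* (0 ℕ.* 1) ℕ.+ u ℕ.+ 1 ℕ.* x₋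
    e = ℕ-solve-∀

  verticalTerm : ℤ → ℕ
  verticalTerm K = [ verticalμ? K ] ℕ.* thickness (K - 1ℤ)

  verticalTerm[K+1] : ∀ K → verticalTerm (K + 1ℤ) ≡ [ depth μ K ℕP.≟ suc (depth μ (K + 1ℤ)) ] ℕ.* thickness K
  verticalTerm[K+1] K = shifted (K + 1ℤ - 1ℤ) (i+1-1≡i K)
    where
    shifted : ∀ K′ → K′ ≡ K → [ depth μ K′ ℕP.≟ suc (depth μ (K + 1ℤ)) ] ℕ.* thickness K′
                              ≡ [ depth μ K ℕP.≟ suc (depth μ (K + 1ℤ)) ] ℕ.* thickness K
    shifted _ refl = refl

  -- A local identity per diagonal whose sum over the window telescopes to
  -- Σ outsideTerm = Σ insideTerm + #rises.
  corner-balance : ∀ K → outsideTerm K ℕ.+ verticalTerm (K + 1ℤ) ≡ insideTerm K ℕ.+ [ up? K ] ℕ.+ verticalTerm K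
  corner-balance K = begin
      outsideTerm K ℕ.+ verticalTerm (K + 1ℤ)
    ≡⟨ cong₂ ℕ._+_ (cong (thickness K ℕ.*_) ([×-dec]≡* (verticalμ? K) (depth μ K ℕP.≟ depth μ (K + 1ℤ))))
                   (verticalTerm[K+1] K) ⟩
      thickness K ℕ.* ([ verticalμ? K ] ℕ.* [ depth μ K ℕP.≟ depth μ (K + 1ℤ) ])
        ℕ.+ [ depth μ K ℕP.≟ suc (depth μ (K + 1ℤ)) ] ℕ.* thickness K
    ≡⟨ balance-bits (thickness K) (thickness (K - 1ℤ)) _ _ _ _ _ (stepBits K) (nextStepBits K) ⟩
      thickness K ℕ.* ([ horizontalμ? K ] ℕ.* [ depth μ K ℕP.≟ suc (depth μ (K + 1ℤ)) ])
        ℕ.+ [ up? K ] ℕ.+ verticalTerm K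
    ≡⟨ cong (λ z → thickness K ℕ.* z ℕ.+ [ up? K ] ℕ.+ verticalTerm K)
            (sym ([×-dec]≡* (horizontalμ? K) (depth μ K ℕP.≟ suc (depth μ (K + 1ℤ))))) ⟩
      insideTerm K ℕ.+ [ up? K ] ℕ.+ verticalTerm K
    ∎
    where open ≡-Reasoning

  outsideSum≡insideSum+#rises : sum (map outsideTerm window) ≡ sum (map insideTerm window) ℕ.+ sum (map (λ K → [ up? K ]) window)
  outsideSum≡insideSum+#rises = ℕP.+-cancelʳ-≡ X _ _ (begin
      sum (map outsideTerm window) ℕ.+ X
    ≡⟨ cong (sum (map outsideTerm window) ℕ.+_) (sym (cong sum (map-interval-shift verticalTerm start span))) ⟩
      sum (map outsideTerm window) ℕ.+ sum (map (λ K → verticalTerm (K + 1ℤ)) window)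
    ≡⟨ sym (sum-map-+ window outsideTerm (λ K → verticalTerm (K + 1ℤ))) ⟩
      sum (map (λ K → outsideTerm K ℕ.+ verticalTerm (K + 1ℤ)) window)
    ≡⟨ sum-map-cong window (λ K _ → corner-balance K) ⟩
      sum (map (λ K → insideTerm K ℕ.+ [ up? K ] ℕ.+ verticalTerm K) window)
    ≡⟨ sum-map-+ window (λ K → insideTerm K ℕ.+ [ up? K ]) verticalTerm ⟩
      sum (map (λ K → insideTerm K ℕ.+ [ up? K ]) window) ℕ.+ sum (map verticalTerm window)
    ≡⟨ cong₂ ℕ._+_ (sum-map-+ window insideTerm (λ K → [ up? K ]))
                   (sum-interval-shift verticalTerm start span (vanishes thickness-start) (vanishes thickness-end)) ⟩
      sum (map insideTerm window) ℕ.+ sum (map (λ K → [ up? K ]) window) ℕ.+ X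
    ∎)
    where
    open ≡-Reasoning
    X : ℕ
    X = sum (map verticalTerm (interval (start + 1ℤ) span))
    vanishes : ∀ {K} → thickness (K - 1ℤ) ≡ 0 → verticalTerm K ≡ 0
    vanishes {K} thin = trans (cong ([ verticalμ? K ] ℕ.*_) thin) (ℕP.*-zeroʳ [ verticalμ? K ])

  rank≡#rises : rank lam μ ≡ + length (filter up? window)
  rank≡#rises = begin
      + cornerSum (outsideCorner? lam μ) - + cornerSum (insideCorner? lam μ)
    ≡⟨ cong₂ (λ o i → + o - + i) (trans outsideSum≡ (trans outsideSum≡insideSum+#rises
                                   (cong (I ℕ.+_) (sym (length-filter up? window))))) insideSum≡ ⟩
      + (I ℕ.+ length (filter up? window)) - + I
    ≡⟨ cong (_- + I) (ℤP.pos-+ I (length (filter up? window))) ⟩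
      + I + + length (filter up? window) - + I
    ≡⟨ e (+ I) (+ length (filter up? window)) ⟩
      + length (filter up? window)
    ∎
    where
    open ≡-Reasoning
    I : ℕ
    I = sum (map insideTerm window)
    e : ∀ a b → a + b - a ≡ b
    e = solve-∀

proposition4p3 : (lam μ : List ℕ) → IsPartition lam → IsPartition μ → μ ⊆ᵖ lam →
    ∃[ P ] (Valid lam μ P
    × ((P′ : List (ℤ × ℤ)) → Valid lam μ P′ → (x : ℤ × ℤ) → (x ∈ P′ ⇔ x ∈ P)))
proposition4p3 lam μ pλ pμ μ⊆λ = countedByRank M.matching-exists-unique
  where
  open Skew lam μ pλ pμ μ⊆λ
  open Rank lam μ pλ pμ μ⊆λ
  module M = FirstReturnMatching thickness start span rise≤1 fall≤1 thickness-flat-outside thickness-start thickness-end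
                                 (snakeSeq lam μ) L⇒up R⇒down up⇒L down⇒R
  countedByRank : ∃[ P ] (M.IsMatching P × ((P′ : List (ℤ × ℤ)) → M.IsMatching P′ → (x : ℤ × ℤ) → (x ∈ P′ ⇔ x ∈ P))) →
                  ∃[ P ] (Valid lam μ P × ((P′ : List (ℤ × ℤ)) → Valid lam μ P′ → (x : ℤ × ℤ) → (x ∈ P′ ⇔ x ∈ P)))
  countedByRank (P , (#P≡#rises , conditions) , unique) =
    P , (trans (cong +_ #P≡#rises) (sym rank≡#rises) , conditions) ,
    λ P′ (#P′≡rank , conditions′) → unique P′ (ℤP.+-injective (trans #P′≡rank rank≡#rises) , conditions′)
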